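{- Let $R$ be a special rim hook tableau of shape $\lambda=(\lambda_1,\dots,\lambda_\ell)\vdash n$. (1) For each $i\in[\ell]$, $\Gamma_i(R)=\lambda_i-i+\operatorname{perm}_{\mathrm{SRT}}(R)_i$. (2) The image of the map $R\mapsto\operatorname{perm}_{\mathrm{SRT}}(R)$, defined on special rim hook tableaux of shape $\lambda$, is the set of permutations $\sigma\in S_\ell$ such that $\lambda_i-i+\sigma_i\ge0$ for all $i\in[\ell]$.
   Context: For a partition $\lambda=(\lambda_1\ge\dots\ge\lambda_\ell>0)$, its Ferrers diagram is the set of cells $(i,j)$, $1\le i\le\ell$, $1\le j\le\lambda_i$ (row $i$ from the top). A rim hook is a connected skew diagram (difference of two Ferrers diagrams of partitions) containing no $2\times2$ square. A special rim hook tableau (SRT) of shape $\lambda$ is a partition of the diagram of $\lambda$ into rim hooks each containing a cell of the first column. The initial cell of a rim hook is its northeastern-most cell; the terminal cell is its southwestern-most cell. The $d$-th diagonal is $\mathcal L_d=\{(d+k,1+k):k\in\mathbb Z\}$; each diagonal contains at most one initial cell of an SRT. $\operatorname{perm}_{\mathrm{SRT}}(R)=\sigma\in S_\ell$ is defined for $i\in[\ell]$ by: if $\mathcal L_{i-\lambda_i+1}$ contains no initial cell, $\sigma_i=i-\lambda_i$; otherwise $\sigma_i$ is the row of the terminal cell of the rim hook whose initial cell lies in $\mathcal L_{i-\lambda_i+1}$. For a rim hook $\mathfrak g$, $|\mathfrak g|$ is its number of cells. $\Gamma(R)=(\Gamma_1(R),\dots,\Gamma_\ell(R))$ where $\Gamma_i(R)=|\mathfrak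 g|$ if there is a rim hook $\mathfrak g$ of $R$ with initial cell on the diagonal $\mathcal L_{i-\lambda_i+1}$, and $\Gamma_i(R)=0$ otherwise. -}

module Defs where

open import Data.Nat using (ℕ; zero; suc; _≤_; _<_; _≥_; _≤ᵇ_)
open import Data.Bool using (Bool; true; false; _∧_; if_then_else_)
open import Data.Integer as ℤ using (ℤ; +_)
open import Data.Integer.Properties using (_≟_)
open import Data.List using (List; []; _∷_; length; concat)
open import Data.Bool.ListAction using (all; any)
open import Data.List.Membership.Propositional using (_∈_)
open import Data.List.Relation.Unary.Linked using (Linked)
open import Data.List.Relation.Unary.All using (All)
open import Data.List.Relation.Unary.Unique.Propositional using (Unique)
open import Data.Maybe using (Maybe; just; nothing)
open import Data.Product using (Σ; ∃; _×_; _,_; proj₁; proj₂)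
open import Data.Fin using (Fin; toℕ)
open import Relation.Nullary using (¬_; does)
open import Relation.Binary.PropositionalEquality using (_≡_)

IsPartition : List ℕ → Set
IsPartition μ = Linked _≥_ μ × All (λ x → 0 < x) μ

-- 1-indexed part:  part μ i = μ_i  for 1 ≤ i ≤ ℓ, and 0 otherwise.
part : List ℕ → ℕ → ℕ
part []      _             = 0
part (_ ∷ _) zero          = 0
part (x ∷ _) (suc zero)    = x
part (_ ∷ μ) (suc (suc i)) = part μ (suc i)

-- Cells (i , j) : row i (from the top), column j; 1-indexed.
Cell : Set
Cell = ℕ × ℕ

row : Cell → ℕ
row = proj₁

col : Cell → ℕ
col = proj₂

InDiagram : List ℕ → Cell → Set
InDiagram μ (i , j) = 1 ≤ i × 1 ≤ j × j ≤ part μ i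

-- Rim hooks.  A finite set of cells is represented by a duplicate-free
-- list of cells (duplicate-freeness is imposed in `IsSRT` below).

IsSkewDiagram : List Cell → Set
IsSkewDiagram g =
  Σ (List ℕ) λ μ → Σ (List ℕ) λ ν →
    IsPartition μ × IsPartition ν ×
    (∀ i → part ν i ≤ part μ i) ×
    (∀ c → (c ∈ g → InDiagram μ c × ¬ InDiagram ν c) ×
           (InDiagram μ c × ¬ InDiagram ν c → c ∈ g))

data Adjacent : Cell → Cell → Set where
  east  : ∀ {i j} → Adjacent (i , j) (i , suc j)
  west  : ∀ {i j} → Adjacent (i , suc j) (i , j)
  south : ∀ {i j} → Adjacent (i , j) (suc i , j)
  north : ∀ {i j} → Adjacent (suc i , j) (i , j)

data PathIn (g : List Cell) : Cell → Cell → Set where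
  here : ∀ {a} → PathIn g a a
  step : ∀ {a b c} → Adjacent a b → b ∈ g → PathIn g b c → PathIn g a c

Connected : List Cell → Set
Connected g = ∀ a b → a ∈ g → b ∈ g → PathIn g a b

No2x2 : List Cell → Set
No2x2 g = ∀ i j →
  ¬ ((i , j) ∈ g × (suc i , j) ∈ g × (i , suc j) ∈ g × (suc i , suc j) ∈ g)

IsRimHook : List Cell → Set
IsRimHook g = IsSkewDiagram g × Connected g × No2x2 g

record IsSRT (λ' : List ℕ) (R : List (List Cell)) : Set where
  field
    rimHooks    : ∀ g → g ∈ R → IsRimHook g
    firstColumn : ∀ g → g ∈ R → ∃ λ c → c ∈ g × col c ≡ 1
    inside      : ∀ g c → g ∈ R → c ∈ g → InDiagram λ' c
    covers      : ∀ c → InDiagram λ' c → ∃ λ g → g ∈ R × c ∈ g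
    disjoint    : Unique (concat R)

isInitialᵇ : List Cell → Cell → Bool
isInitialᵇ g c = all (λ c' → (row c ≤ᵇ row c') ∧ (col c' ≤ᵇ col c)) g

isTerminalᵇ : List Cell → Cell → Bool
isTerminalᵇ g c = all (λ c' → (row c' ≤ᵇ row c) ∧ (col c ≤ᵇ col c')) g

-- (r , c) ∈ 𝓛_d  iff  r = d + k and c = 1 + k, i.e. d = r - c + 1
onDiagonalᵇ : ℤ → Cell → Bool
onDiagonalᵇ d (r , c) = does (d ≟ ((+ r ℤ.- + c) ℤ.+ + 1))

hasInitialOnᵇ : ℤ → List Cell → Bool
hasInitialOnᵇ d g = any (λ c → isInitialᵇ g c ∧ onDiagonalᵇ d c) g

hookOn : ℤ → List (List Cell) → Maybe (List Cell)
hookOn d []      = nothing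
hookOn d (g ∷ R) = if hasInitialOnᵇ d g then just g else hookOn d R

terminalRow : List Cell → Maybe ℕ
terminalRow g = go g
  where
  go : List Cell → Maybe ℕ
  go []       = nothing
  go (c ∷ cs) = if isTerminalᵇ g c then just (row c) else go cs

diagIndex : List ℕ → ℕ → ℤ
diagIndex λ' i = (+ i ℤ.- + part λ' i) ℤ.+ + 1

permSRT : List ℕ → List (List Cell) → ℕ → ℤ
permSRT λ' R i with hookOn (diagIndex λ' i) R
... | nothing = + i ℤ.- + part λ' i
... | just g with terminalRow g
...   | just r  = + r
...   | nothing = + 0   -- unreachable for a rim hook

Γ : List ℕ → List (List Cell) → ℕ → ℕ
Γ λ' R i with hookOn (diagIndex λ' i) R
... | nothing = 0
... | just g  = length g

-- 1-indexed position of an element of Fin ℓ, i.e. [ℓ] = {1,…,ℓ}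
pos : ∀ {ℓ} → Fin ℓ → ℕ
pos i = suc (toℕ i)

{-# OPTIONS --safe #-}
module Submission where

-- The contents col − row of the cells of a rim hook are distinct and, the hook being connected,
-- fill an interval; for a hook with initial cell (a , b) on the diagonal of row i and terminal
-- cell (t , 1) it is [1 − t , b − a], so the hook has b − a + t = λᵢ − i + t cells, which is (1).
-- For (2): if no initial cell lies on the diagonal of row i, every cell of that diagonal in rows
-- 1 … i continues, inside its hook, to a cell of the next diagonal in rows 1 … i − 1, and these
-- continuations are distinct; by pigeonhole this is impossible unless λᵢ < i.  The same count
-- shows that i − λᵢ is never the terminal row of a hook, and distinct rows end on distinct
-- diagonals, so perm_SRT(R) is injective on [ℓ], hence a permutation, and λᵢ − i + σᵢ = Γᵢ ≥ 0.
-- Conversely, for an admissible σ let i = σ⁻¹(ℓ): removing the rim hook from (i , λᵢ) to (ℓ , 1)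
-- leaves a shape with ℓ − 1 rows on which σ, with row i deleted, is again admissible, and
-- induction on ℓ builds the tableau.

module RimHookTableaux where

  open import Defs
  open import Data.Nat as ℕ using (ℕ; zero; suc; _+_; _∸_; _≤_; _<_; _≥_; z≤n; s≤s; _≤?_; _<?_; _≤ᵇ_)
  open import Data.Nat.Properties as ℕ
    using (≤-refl; ≤-trans; ≤-antisym; n≤1+n; n<1+n; m≤n⇒m≤1+n; <-irrefl; ≮⇒≥; ≤ᵇ⇒≤; ≤⇒≤ᵇ;
           ∸-cancelʳ-≡; ≤∧≢⇒<)
  open import Data.Nat.Tactic.RingSolver using (solve-∀)
  open import Data.Integer as ℤ using (ℤ; +_)
  open import Data.Integer.Properties as ℤP using (pos-+; +-injective)
  open import Data.Integer.Tactic.RingSolver using () renaming (solve-∀ to solve-∀ℤ)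
  open import Data.Bool using (T; _∧_; true; false; if_then_else_)
  open import Data.Bool.Properties using (T-∧)
  open import Data.Fin as Fin using (Fin; toℕ; fromℕ<; punchOut)
  open import Data.Fin.Properties
    using (toℕ-fromℕ<; toℕ≤pred[n]; toℕ<n; toℕ-injective; <⇒notInjective; injective⇒≤; punchOut-injective;
           cantor-schröder-bernstein; any?; _≟_)
  open import Data.Fin.Permutation using (Permutation′; permutation; _⟨$⟩ʳ_; _⟨$⟩ˡ_; inverseˡ; inverseʳ)
  open import Data.List using (List; []; _∷_; length; lookup; _++_; concat; filter; cartesianProduct; upTo)
  open import Data.List.Membership.Propositional using (_∈_; find; lose)
  open import Data.List.Membership.Propositional.Properties
    using (∈-lookup; ∈-++⁺ʳ; ∈-concat⁺′; ∈-concat⁻′; ∈-filter⁺; ∈-filter⁻; ∈-cartesianProduct⁺; ∈-upTo⁺)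
  open import Data.List.Membership.Setoid.Properties using (index-injective)
  open import Data.List.Relation.Unary.Any using (here; there; index)
  open import Data.List.Relation.Unary.Any.Properties using (any⁺; any⁻)
  open import Data.List.Relation.Unary.All as All using (All; []; _∷_)
  open import Data.List.Relation.Unary.All.Properties as All using (all⁺; all⁻; ¬All⇒Any¬)
  open import Data.List.Relation.Unary.AllPairs using ([]; _∷_)
  open import Data.List.Relation.Unary.Linked using (Linked; []; [-]; _∷_)
  open import Data.List.Relation.Unary.Unique.Propositional using (Unique)
  import Data.List.Relation.Unary.Unique.Propositional.Properties as Unique
  import Data.List.Extrema
  open import Data.Maybe using (Maybe; just; nothing)
  open import Data.Product using (Σ; ∃; _×_; _,_; proj₁; proj₂)
  open import Data.Sum using (_⊎_; inj₁; inj₂)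
  open import Data.Empty using (⊥; ⊥-elim)
  open import Data.Unit using (tt)
  open import Function using (_∘_; id; Equivalence)
  open import Function.Definitions using (Injective)
  open import Relation.Nullary using (¬_; yes; no; Dec; contradiction)
  open import Relation.Nullary.Decidable using (_×-dec_; ¬?)
  open import Relation.Binary.Definitions using (tri<; tri≈; tri>)
  open import Relation.Binary.PropositionalEquality as ≡
    using (_≡_; _≢_; refl; sym; trans; cong; cong₂; subst; subst₂)

  -- Finite combinatorics

  pigeonhole-ℕ : ∀ n (Rel : ℕ → ℕ → Set) → (∀ {i} → i ≤ n → ∃ λ j → j < n × Rel i j) →
    (∀ {i i′ j} → Rel i j → Rel i′ j → i ≡ i′) → ⊥
  pigeonhole-ℕ n Rel image functional = <⇒notInjective (n<1+n n) squeeze-injective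
    where
    squeeze : Fin (suc n) → Fin n
    squeeze k = fromℕ< (proj₁ (proj₂ (image (toℕ≤pred[n] k))))

    squeeze-injective : Injective _≡_ _≡_ squeeze
    squeeze-injective {k} {k′} eq = toℕ-injective (functional (proj₂ (proj₂ (image (toℕ≤pred[n] k)))) rel′)
      where
      same-image : proj₁ (image (toℕ≤pred[n] k′)) ≡ proj₁ (image (toℕ≤pred[n] k))
      same-image = trans (sym (toℕ-fromℕ< _)) (trans (cong toℕ (sym eq)) (toℕ-fromℕ< _))
      rel′ = ≡.subst (Rel (toℕ k′)) same-image (proj₂ (proj₂ (image (toℕ≤pred[n] k′))))

  toFin : ∀ {n v} → 1 ≤ v → v ≤ n → Fin n
  toFin {v = suc _} _ v≤n = fromℕ< v≤n

  pos-toFin : ∀ {n v} (1≤v : 1 ≤ v) (v≤n : v ≤ n) → pos (toFin 1≤v v≤n) ≡ v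
  pos-toFin {v = suc _} _ v≤n = cong suc (toℕ-fromℕ< v≤n)

  at-position : ∀ {n} (P : ℕ → Set) → (∀ (i : Fin n) → P (pos i)) → ∀ {x} → 1 ≤ x → x ≤ n → P x
  at-position P holds 1≤x x≤n = ≡.subst P (pos-toFin 1≤x x≤n) (holds (toFin 1≤x x≤n))

  onPositions : ∀ {n} → (Fin n → ℕ) → ℕ → ℕ
  onPositions {zero}  f _             = 0
  onPositions {suc n} f zero          = 0
  onPositions {suc n} f (suc zero)    = f Fin.zero
  onPositions {suc n} f (suc (suc x)) = onPositions (λ i → f (Fin.suc i)) (suc x)

  onPositions-pos : ∀ {n} (f : Fin n → ℕ) i → onPositions f (pos i) ≡ f i
  onPositions-pos f Fin.zero    = refl
  onPositions-pos f (Fin.suc i) = onPositions-pos (λ i → f (Fin.suc i)) i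

  pos-injective : ∀ {n} {i j : Fin n} → pos i ≡ pos j → i ≡ j
  pos-injective = toℕ-injective ∘ ℕ.suc-injective

  injective⇒surjective : ∀ {n} (f : Fin n → Fin n) → Injective _≡_ _≡_ f → ∀ y → ∃ λ x → f x ≡ y
  injective⇒surjective {zero}  f f-inj ()
  injective⇒surjective {suc n} f f-inj y with any? (λ x → f x ≟ y)
  ... | yes found = found
  ... | no  missed = contradiction (injective⇒≤ avoid-injective) ℕ.1+n≰n
    where
    y≢f : ∀ x → y ≢ f x
    y≢f x y≡fx = missed (x , sym y≡fx)
    avoid : Fin (suc n) → Fin n
    avoid x = punchOut (y≢f x)
    avoid-injective : Injective _≡_ _≡_ avoid
    avoid-injective {x} {x′} eq = f-inj (punchOut-injective (y≢f x) (y≢f x′) eq)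

  injective⇒permutation : ∀ {n} (f : Fin n → Fin n) → Injective _≡_ _≡_ f →
    Σ (Permutation′ n) λ σ → ∀ i → σ ⟨$⟩ʳ i ≡ f i
  injective⇒permutation f f-inj =
    permutation f (λ y → proj₁ (onto y)) (λ y → proj₂ (onto y)) (λ x → f-inj (proj₂ (onto (f x)))) ,
    λ _ → refl
    where onto = injective⇒surjective f f-inj

  Unique⇒lookup-injective : ∀ {A : Set} {xs : List A} → Unique xs → Injective _≡_ _≡_ (lookup xs)
  Unique⇒lookup-injective {xs = _ ∷ _}  _           {Fin.zero}  {Fin.zero}  _  = refl
  Unique⇒lookup-injective {xs = _ ∷ xs} (x∉ ∷ _)    {Fin.zero}  {Fin.suc j} eq = ⊥-elim (All.lookup x∉ (∈-lookup j) eq)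
  Unique⇒lookup-injective {xs = _ ∷ xs} (x∉ ∷ _)    {Fin.suc i} {Fin.zero}  eq = ⊥-elim (All.lookup x∉ (∈-lookup i) (sym eq))
  Unique⇒lookup-injective {xs = _ ∷ xs} (_ ∷ uniq) {Fin.suc i} {Fin.suc j} eq = cong Fin.suc (Unique⇒lookup-injective uniq eq)

  length-by-labelling : ∀ {A : Set} {xs : List A} {n} (f : A → ℕ) → Unique xs →
    (∀ {x} → x ∈ xs → 1 ≤ f x × f x ≤ n) →
    (∀ {x y} → x ∈ xs → y ∈ xs → f x ≡ f y → x ≡ y) →
    (∀ {k} → 1 ≤ k → k ≤ n → ∃ λ x → x ∈ xs × f x ≡ k) →
    length xs ≡ n
  length-by-labelling {xs = xs} {n} f uniq range f-inj onto =
    cantor-schröder-bernstein {f = label} {g = preimage} label-injective preimage-injective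
    where
    label-bound : ∀ i → f (lookup xs i) ∸ 1 < n
    label-bound i with f (lookup xs i) | range (∈-lookup {xs = xs} i)
    ... | suc k | _ , k<n = k<n

    label : Fin (length xs) → Fin n
    label i = fromℕ< (label-bound i)

    label-injective : Injective _≡_ _≡_ label
    label-injective {i} {j} eq = Unique⇒lookup-injective uniq (f-inj (∈-lookup i) (∈-lookup j) same-label)
      where
      same-label : f (lookup xs i) ≡ f (lookup xs j)
      same-label = ∸-cancelʳ-≡ (proj₁ (range (∈-lookup i))) (proj₁ (range (∈-lookup j)))
                     (trans (sym (toℕ-fromℕ< _)) (trans (cong toℕ eq) (toℕ-fromℕ< _)))

    preimage-of : (k : Fin n) → ∃ λ x → x ∈ xs × f x ≡ suc (toℕ k)
    preimage-of k = onto (s≤s z≤n) (toℕ<n k)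

    preimage : Fin n → Fin (length xs)
    preimage k = index (proj₁ (proj₂ (preimage-of k)))

    preimage-injective : Injective _≡_ _≡_ preimage
    preimage-injective {k} {k′} eq = toℕ-injective (ℕ.suc-injective (begin
      suc (toℕ k)          ≡⟨ sym (proj₂ (proj₂ (preimage-of k))) ⟩
      f (proj₁ (preimage-of k))  ≡⟨ cong f (index-injective (≡.setoid _) (proj₁ (proj₂ (preimage-of k)))
                                                                   (proj₁ (proj₂ (preimage-of k′))) eq) ⟩
      f (proj₁ (preimage-of k′)) ≡⟨ proj₂ (proj₂ (preimage-of k′)) ⟩
      suc (toℕ k′)         ∎))
      where open ≡.≡-Reasoning

  module _ {A : Set} where

    Unique-++⁻ˡ : ∀ {xs ys : List A} → Unique (xs ++ ys) → Unique xs
    Unique-++⁻ˡ {[]}     _            = []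
    Unique-++⁻ˡ {x ∷ xs} (x∉ ∷ uniq) = All.++⁻ˡ xs x∉ ∷ Unique-++⁻ˡ uniq

    Unique-++⁻ʳ : ∀ {xs ys : List A} → Unique (xs ++ ys) → Unique ys
    Unique-++⁻ʳ {[]}     uniq       = uniq
    Unique-++⁻ʳ {x ∷ xs} (_ ∷ uniq) = Unique-++⁻ʳ {xs} uniq

    Unique-++⇒disjoint : ∀ {xs ys : List A} {x} → Unique (xs ++ ys) → x ∈ xs → x ∈ ys → ⊥
    Unique-++⇒disjoint {_ ∷ xs} (x∉ ∷ _)   (here refl) x∈ys = All.lookup x∉ (∈-++⁺ʳ xs x∈ys) refl
    Unique-++⇒disjoint {_ ∷ xs} (_ ∷ uniq) (there x∈xs) x∈ys = Unique-++⇒disjoint uniq x∈xs x∈ys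

    Unique-concat⁻ : ∀ {xss : List (List A)} {xs} → Unique (concat xss) → xs ∈ xss → Unique xs
    Unique-concat⁻ {ys ∷ _} uniq (here refl)  = Unique-++⁻ˡ uniq
    Unique-concat⁻ {ys ∷ _} uniq (there xs∈) = Unique-concat⁻ (Unique-++⁻ʳ {ys} uniq) xs∈

    Unique-concat⇒≡ : ∀ {xss : List (List A)} {xs ys x} → Unique (concat xss) →
      xs ∈ xss → ys ∈ xss → x ∈ xs → x ∈ ys → xs ≡ ys
    Unique-concat⇒≡ {_ ∷ _}   _    (here refl)  (here refl)  _    _    = refl
    Unique-concat⇒≡ {_ ∷ xss} uniq (here refl)  (there ys∈) x∈xs x∈ys =
      ⊥-elim (Unique-++⇒disjoint uniq x∈xs (∈-concat⁺′ x∈ys ys∈))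
    Unique-concat⇒≡ {_ ∷ xss} uniq (there xs∈) (here refl)  x∈xs x∈ys =
      ⊥-elim (Unique-++⇒disjoint uniq x∈ys (∈-concat⁺′ x∈xs xs∈))
    Unique-concat⇒≡ {zs ∷ _}  uniq (there xs∈) (there ys∈) x∈xs x∈ys =
      Unique-concat⇒≡ (Unique-++⁻ʳ {zs} uniq) xs∈ ys∈ x∈xs x∈ys

  Adjacent-sym : ∀ {a b} → Adjacent a b → Adjacent b a
  Adjacent-sym east  = west
  Adjacent-sym west  = east
  Adjacent-sym south = north
  Adjacent-sym north = south

  module _ {g : List Cell} where

    path-++ : ∀ {a b c} → PathIn g a b → PathIn g b c → PathIn g a c
    path-++ here                q = q
    path-++ (step a~b b∈g rest) q = step a~b b∈g (path-++ rest q)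

    path-reverse : ∀ {a b} → a ∈ g → PathIn g a b → PathIn g b a
    path-reverse a∈g here                = here
    path-reverse a∈g (step a~b b∈g rest) = path-++ (path-reverse b∈g rest) (step (Adjacent-sym a~b) a∈g here)

    connected-via-hub : ∀ {h} → (∀ {a} → a ∈ g → PathIn g a h) → Connected g
    connected-via-hub to-hub a b a∈g b∈g = path-++ (to-hub a∈g) (path-reverse b∈g (to-hub b∈g))

    path-intermediate-value : (m : Cell → ℕ) → (∀ {c d} → Adjacent c d → m d ≤ suc (m c)) →
      ∀ {a b k} → a ∈ g → PathIn g a b → m a ≤ k → k ≤ m b → ∃ λ c → c ∈ g × m c ≡ k
    path-intermediate-value m lipschitz a∈g here ma≤k k≤mb = _ , a∈g , ≤-antisym ma≤k k≤mb
    path-intermediate-value m lipschitz {a} {k = k} a∈g (step a~b b∈g rest) ma≤k k≤mb with m a ℕ.≟ k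
    ... | yes ma≡k = a , a∈g , ma≡k
    ... | no  ma≢k = path-intermediate-value m lipschitz b∈g rest (≤-trans (lipschitz a~b) (≤∧≢⇒< ma≤k ma≢k)) k≤mb

  -- Shapes

  Antitone : (ℕ → ℕ) → Set
  Antitone p = ∀ {x y} → 1 ≤ x → x ≤ y → p y ≤ p x

  antitone-by-steps : ∀ {p} → (∀ x → 1 ≤ x → p (suc x) ≤ p x) → Antitone p
  antitone-by-steps {p} one-step {x} 1≤x x≤y with ℕ.m≤n⇒∃[o]m+o≡n x≤y
  ... | d , refl = descend d
    where
    descend : ∀ d → p (x + d) ≤ p x
    descend zero    rewrite ℕ.+-identityʳ x = ≤-refl
    descend (suc d) rewrite ℕ.+-suc x d = ≤-trans (one-step (x + d) (≤-trans 1≤x (ℕ.m≤m+n x d))) (descend d)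

  antitone-shift : ∀ {p} → Antitone p → Antitone (p ∘ suc)
  antitone-shift antitone _ x≤y = antitone (s≤s z≤n) (s≤s x≤y)

  VanishesAbove : (ℕ → ℕ) → ℕ → Set
  VanishesAbove p L = ∀ {x} → L < x → p x ≡ 0

  InShape : (ℕ → ℕ) → Cell → Set
  InShape p (i , j) = 1 ≤ i × 1 ≤ j × j ≤ p i

  inShape-row≤ : ∀ {p L c} → VanishesAbove p L → InShape p c → row c ≤ L
  inShape-row≤ {p} {L} {i , j} vanishes (_ , 1≤j , j≤pi) =
    ℕ.≮⇒≥ λ L<i → ℕ.<-irrefl refl (ℕ.<-≤-trans 1≤j (≤-trans j≤pi (ℕ.≤-reflexive (vanishes L<i))))

  part-zero : ∀ μ → part μ 0 ≡ 0
  part-zero []      = refl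
  part-zero (_ ∷ _) = refl

  part-antitone : ∀ {μ} → Linked _≥_ μ → Antitone (part μ)
  part-antitone {μ} linked = antitone-by-steps (one-step μ linked)
    where
    one-step : ∀ μ → Linked _≥_ μ → ∀ x → 1 ≤ x → part μ (suc x) ≤ part μ x
    one-step []          _          _             _ = z≤n
    one-step (_ ∷ [])    _          (suc _)       _ = z≤n
    one-step (_ ∷ _ ∷ _) (a≥b ∷ _)  (suc zero)    _ = a≥b
    one-step (_ ∷ b ∷ μ) (_ ∷ rest) (suc (suc x)) _ = one-step (b ∷ μ) rest (suc x) (s≤s z≤n)

  part-vanishes : ∀ μ → VanishesAbove (part μ) (length μ)
  part-vanishes []      _                 = refl
  part-vanishes (_ ∷ μ) {suc (suc x)} (s≤s ℓ<x) = part-vanishes μ ℓ<x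

  part-positive : ∀ {μ} → All (0 <_) μ → ∀ {x} → 1 ≤ x → x ≤ length μ → 1 ≤ part μ x
  part-positive (0<a ∷ _)  {suc zero}    _ _         = 0<a
  part-positive (_ ∷ pos)  {suc (suc x)} _ (s≤s x≤ℓ) = part-positive pos (s≤s z≤n) x≤ℓ

  antitone-part⇒linked : ∀ μ → Antitone (part μ) → Linked _≥_ μ
  antitone-part⇒linked []          _        = []
  antitone-part⇒linked (_ ∷ [])    _        = [-]
  antitone-part⇒linked (_ ∷ b ∷ μ) antitone =
    antitone {1} {2} (s≤s z≤n) (s≤s z≤n) ∷ antitone-part⇒linked (b ∷ μ) tail-antitone
    where
    tail-antitone : Antitone (part (b ∷ μ))
    tail-antitone {suc _} {suc _} _ (s≤s x≤y) = antitone (s≤s z≤n) (s≤s (s≤s x≤y))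

  consIfPositive : ℕ → List ℕ → List ℕ
  consIfPositive zero    _  = []
  consIfPositive (suc a) μ = suc a ∷ μ

  toPartition : (ℕ → ℕ) → ℕ → List ℕ
  toPartition p zero    = []
  toPartition p (suc n) = consIfPositive (p 1) (toPartition (p ∘ suc) n)

  part-toPartition : ∀ {p} n → Antitone p → VanishesAbove p n → ∀ {x} → 1 ≤ x → part (toPartition p n) x ≡ p x
  part-toPartition zero    _ vanishes 1≤x = sym (vanishes 1≤x)
  part-toPartition {p} (suc n) antitone vanishes {x} 1≤x with p 1 in p1≡
  ... | zero  = sym (ℕ.n≤0⇒n≡0 (subst (p x ≤_) p1≡ (antitone ≤-refl 1≤x)))
  part-toPartition {p} (suc n) antitone vanishes {suc zero}    _ | suc _ = sym p1≡
  part-toPartition {p} (suc n) antitone vanishes {suc (suc x)} _ | suc _ =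
    part-toPartition n (antitone-shift antitone) (λ n<y → vanishes (s≤s n<y)) (s≤s z≤n)

  toPartition-positive : ∀ p n → All (0 <_) (toPartition p n)
  toPartition-positive p zero = []
  toPartition-positive p (suc n) with p 1
  ... | zero  = []
  ... | suc _ = s≤s z≤n ∷ toPartition-positive (p ∘ suc) n

  toPartition-isPartition : ∀ {p} n → Antitone p → VanishesAbove p n → IsPartition (toPartition p n)
  toPartition-isPartition {p} n antitone vanishes =
    antitone-part⇒linked _ (λ {x} {y} 1≤x x≤y →
      subst₂ _≤_ (sym (agrees (≤-trans 1≤x x≤y))) (sym (agrees 1≤x)) (antitone 1≤x x≤y)) ,
    toPartition-positive p n
    where agrees = part-toPartition n antitone vanishes

  toPartition-diagram⇒ : ∀ {p n} → Antitone p → VanishesAbove p n → ∀ {c} → InDiagram (toPartition p n) c → InShape p c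
  toPartition-diagram⇒ {n = n} antitone vanishes (1≤i , 1≤j , j≤) =
    1≤i , 1≤j , subst (_ ≤_) (part-toPartition n antitone vanishes 1≤i) j≤

  toPartition-diagram⇐ : ∀ {p n} → Antitone p → VanishesAbove p n → ∀ {c} → InShape p c → InDiagram (toPartition p n) c
  toPartition-diagram⇐ {n = n} antitone vanishes (1≤i , 1≤j , j≤) =
    1≤i , 1≤j , subst (_ ≤_) (sym (part-toPartition n antitone vanishes 1≤i)) j≤

  -- Diagonals

  record SameDiagonal (c d : Cell) : Set where
    constructor sameDiagonal
    field balanced : col c + row d ≡ col d + row c

  record NextDiagonal (c d : Cell) : Set where
    constructor nextDiagonal
    field shifted : col d + row c ≡ suc (col c + row d)

  private
    swap-middle : ∀ a b c d → (a + b) + (c + d) ≡ (a + d) + (c + b)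
    swap-middle = solve-∀

    swap-outer : ∀ a b c d → (a + b) + (c + d) ≡ (c + b) + (a + d)
    swap-outer = solve-∀

  SameDiagonal-sym : ∀ {c d} → SameDiagonal c d → SameDiagonal d c
  SameDiagonal-sym (sameDiagonal eq) = sameDiagonal (sym eq)

  SameDiagonal-trans : ∀ {c d e} → SameDiagonal c d → SameDiagonal d e → SameDiagonal c e
  SameDiagonal-trans {c} {d} {e} (sameDiagonal c~d) (sameDiagonal d~e) = sameDiagonal (ℕ.+-cancelʳ-≡ (col d + row d) _ _ (begin
    (col c + row e) + (col d + row d) ≡⟨ swap-middle (col c) (row e) (col d) (row d) ⟩
    (col c + row d) + (col d + row e) ≡⟨ cong₂ _+_ c~d d~e ⟩
    (col d + row c) + (col e + row d) ≡⟨ swap-outer (col d) (row c) (col e) (row d) ⟩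
    (col e + row c) + (col d + row d) ∎))
    where open ≡.≡-Reasoning

  NextDiagonal-respˡ : ∀ {c e w} → SameDiagonal c e → NextDiagonal c w → NextDiagonal e w
  NextDiagonal-respˡ {c} {e} {w} (sameDiagonal c~e) (nextDiagonal c→w) = nextDiagonal (ℕ.+-cancelʳ-≡ (col c + row c) _ _ (begin
    (col w + row e) + (col c + row c) ≡⟨ swap-middle (col w) (row e) (col c) (row c) ⟩
    (col w + row c) + (col c + row e) ≡⟨ cong₂ _+_ c→w c~e ⟩
    suc (col c + row w) + (col e + row c) ≡⟨ cong suc (swap-outer (col c) (row w) (col e) (row c)) ⟩
    suc (col e + row w) + (col c + row c) ∎))
    where open ≡.≡-Reasoning

  +-exchange : ∀ {l a b t x y} → l + a ≡ b + t → b + x ≡ y + a → l + x ≡ y + t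
  +-exchange {l} {a} {b} {t} {x} {y} e₁ e₂ = ℕ.+-cancelʳ-≡ (a + b) _ _ (begin
    (l + x) + (a + b) ≡⟨ split l x a b ⟩
    (l + a) + (b + x) ≡⟨ cong₂ _+_ e₁ e₂ ⟩
    (b + t) + (y + a) ≡⟨ join b t y a ⟩
    (y + t) + (a + b) ∎)
    where
    open ≡.≡-Reasoning
    split : ∀ l x a b → (l + x) + (a + b) ≡ (l + a) + (b + x)
    split = solve-∀
    join : ∀ b t y a → (b + t) + (y + a) ≡ (y + t) + (a + b)
    join = solve-∀

  SameDiagonal-shift : ∀ a b i → SameDiagonal (a + i , b + i) (a , b)
  SameDiagonal-shift a b i = sameDiagonal (shift a b i)
    where
    shift : ∀ a b i → (b + i) + a ≡ b + (a + i)
    shift = solve-∀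

  NextDiagonal-offset : ∀ {a b w} → a ≤ row w → NextDiagonal (a , b) w → w ≡ (a + (row w ∸ a) , suc (b + (row w ∸ a)))
  NextDiagonal-offset {a} {b} {w} a≤r (nextDiagonal a→w) = cong₂ _,_ (sym a+j≡r) (ℕ.+-cancelʳ-≡ a _ _ (begin
    col w + a          ≡⟨ a→w ⟩
    suc (b + row w)    ≡⟨ cong (λ r → suc (b + r)) (sym a+j≡r) ⟩
    suc (b + (a + j))  ≡⟨ cong suc (reorder b a j) ⟩
    suc (b + j) + a    ∎))
    where
    open ≡.≡-Reasoning
    j = row w ∸ a
    a+j≡r = ℕ.m+[n∸m]≡n a≤r
    reorder : ∀ b a j → b + (a + j) ≡ (b + j) + a
    reorder = solve-∀

  NextDiagonal-corner : ∀ {t w} → NextDiagonal (suc t , 1) w → 1 ≤ col w → row w ≤ t → w ≡ (t , 1)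
  NextDiagonal-corner {t} {w} (nextDiagonal t→w) 1≤s r≤t = cong₂ _,_ r≡t s≡1
    where
    s+t≡1+r : col w + t ≡ suc (row w)
    s+t≡1+r = ℕ.suc-injective (trans (sym (ℕ.+-suc (col w) t)) t→w)
    r≡t : row w ≡ t
    r≡t = ≤-antisym r≤t (ℕ.s≤s⁻¹ (≤-trans (ℕ.+-monoˡ-≤ t 1≤s) (ℕ.≤-reflexive s+t≡1+r)))
    s≡1 : col w ≡ 1
    s≡1 = ℕ.+-cancelʳ-≡ t _ _ (trans s+t≡1+r (cong suc r≡t))

  rowEnd-injective : ∀ {p} → Antitone p → ∀ {x y} → 1 ≤ x → 1 ≤ y → SameDiagonal (x , p x) (y , p y) → x ≡ y
  rowEnd-injective antitone {x} {y} 1≤x 1≤y (sameDiagonal same) with ℕ.<-cmp x y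
  ... | tri≈ _ x≡y _ = x≡y
  ... | tri< x<y _ _ = ⊥-elim (<-irrefl (sym same) (ℕ.+-mono-≤-< (antitone 1≤x (ℕ.<⇒≤ x<y)) x<y))
  ... | tri> _ _ y<x = ⊥-elim (<-irrefl same (ℕ.+-mono-≤-< (antitone 1≤y (ℕ.<⇒≤ y<x)) y<x))

  -- The content col − row, shifted by t so that it is a natural number on rows ≤ t.
  shiftedContent : ℕ → Cell → ℕ
  shiftedContent t (i , j) = j + (t ∸ i)

  private
    ∸-suc-≤ : ∀ t i → t ∸ i ≤ suc (t ∸ suc i)
    ∸-suc-≤ zero    zero    = z≤n
    ∸-suc-≤ zero    (suc i) = z≤n
    ∸-suc-≤ (suc t) zero    = ≤-refl
    ∸-suc-≤ (suc t) (suc i) = ∸-suc-≤ t i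

    regroup : ∀ a k r r′ → (a + k) + (r + r′) ≡ (a + r′) + (k + r)
    regroup = solve-∀

  shiftedContent-adjacent : ∀ t {c d} → Adjacent c d → shiftedContent t d ≤ suc (shiftedContent t c)
  shiftedContent-adjacent t east                = ≤-refl
  shiftedContent-adjacent t (west {j = j})      = ℕ.≤-trans (n≤1+n _) (n≤1+n _)
  shiftedContent-adjacent t (south {i} {j})     = m≤n⇒m≤1+n (ℕ.+-monoʳ-≤ j (ℕ.∸-monoʳ-≤ t (n≤1+n i)))
  shiftedContent-adjacent t (north {i} {j})     = ℕ.≤-trans (ℕ.+-monoʳ-≤ j (∸-suc-≤ t i)) (ℕ.≤-reflexive (ℕ.+-suc j _))

  ∸-cross-≤ : ∀ {a b r r′ t} → r ≤ t → r′ ≤ t → a + (t ∸ r) ≤ b + (t ∸ r′) → a + r′ ≤ b + r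
  ∸-cross-≤ {a} {b} {r} {r′} {t} r≤t r′≤t le = ℕ.+-cancelʳ-≤ t _ _ (begin
    (a + r′) + t              ≡⟨ cong (λ z → (a + r′) + z) (sym (ℕ.m∸n+n≡m r≤t)) ⟩
    (a + r′) + ((t ∸ r) + r)  ≡⟨ sym (regroup a (t ∸ r) r r′) ⟩
    (a + (t ∸ r)) + (r + r′)  ≤⟨ ℕ.+-monoˡ-≤ (r + r′) le ⟩
    (b + (t ∸ r′)) + (r + r′) ≡⟨ cong (λ z → (b + (t ∸ r′)) + z) (ℕ.+-comm r r′) ⟩
    (b + (t ∸ r′)) + (r′ + r) ≡⟨ regroup b (t ∸ r′) r′ r ⟩
    (b + r) + ((t ∸ r′) + r′) ≡⟨ cong (λ z → (b + r) + z) (ℕ.m∸n+n≡m r′≤t) ⟩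
    (b + r) + t               ∎)
    where open ℕ.≤-Reasoning

  ∸-cross-≡ : ∀ {a b r r′ t} → r ≤ t → r′ ≤ t → a + (t ∸ r) ≡ b + (t ∸ r′) → a + r′ ≡ b + r
  ∸-cross-≡ r≤t r′≤t eq =
    ≤-antisym (∸-cross-≤ r≤t r′≤t (ℕ.≤-reflexive eq)) (∸-cross-≤ r′≤t r≤t (ℕ.≤-reflexive (sym eq)))

  diagonalThrough : Cell → ℤ
  diagonalThrough (x , y) = (+ x ℤ.- + y) ℤ.+ + 1

  private
    add-sub-cancel : ∀ (a b : ℤ) → a ≡ (a ℤ.+ b) ℤ.- b
    add-sub-cancel = solve-∀ℤ

    add-sub-swap : ∀ (a b c : ℤ) → (a ℤ.+ b) ℤ.- c ≡ (a ℤ.- c) ℤ.+ b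
    add-sub-swap = solve-∀ℤ

    index-split : ∀ (a b s : ℤ) → s ℤ.+ a ≡ ((a ℤ.- b) ℤ.+ + 1) ℤ.+ ((s ℤ.+ b) ℤ.- + 1)
    index-split = solve-∀ℤ

    index-join : ∀ (r s b : ℤ) → ((r ℤ.- s) ℤ.+ + 1) ℤ.+ ((s ℤ.+ b) ℤ.- + 1) ≡ b ℤ.+ r
    index-join = solve-∀ℤ

    index-widen : ∀ (a b s : ℤ) → (a ℤ.- b) ℤ.+ + 1 ≡ ((s ℤ.+ a) ℤ.- (s ℤ.+ b)) ℤ.+ + 1
    index-widen = solve-∀ℤ

    index-narrow : ∀ (b r s : ℤ) → ((b ℤ.+ r) ℤ.- (s ℤ.+ b)) ℤ.+ + 1 ≡ (r ℤ.- s) ℤ.+ + 1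
    index-narrow = solve-∀ℤ

    add-difference : ∀ (a b c : ℤ) → b ℤ.+ ((a ℤ.- b) ℤ.+ c) ≡ a ℤ.+ c
    add-difference = solve-∀ℤ

  pos-+-≡ : ∀ a b c d → a + b ≡ c + d → + a ℤ.+ + b ≡ + c ℤ.+ + d
  pos-+-≡ a b c d eq = trans (sym (pos-+ a b)) (trans (cong +_ eq) (pos-+ c d))

  pos-+-injective : ∀ a b c d → + a ℤ.+ + b ≡ + c ℤ.+ + d → a + b ≡ c + d
  pos-+-injective a b c d eq = +-injective (trans (pos-+ a b) (trans eq (sym (pos-+ c d))))

  pos≡difference+pos : ∀ {l x y t} → l + x ≡ y + t → + l ≡ (+ y ℤ.- + x) ℤ.+ + t
  pos≡difference+pos {l} {x} {y} {t} eq = begin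
    + l                         ≡⟨ add-sub-cancel (+ l) (+ x) ⟩
    (+ l ℤ.+ + x) ℤ.- + x       ≡⟨ cong (ℤ._- + x) (pos-+-≡ l x y t eq) ⟩
    (+ y ℤ.+ + t) ℤ.- + x       ≡⟨ add-sub-swap (+ y) (+ t) (+ x) ⟩
    (+ y ℤ.- + x) ℤ.+ + t       ∎
    where open ≡.≡-Reasoning

  pos-difference : ∀ {m n} → n ≤ m → + m ℤ.- + n ≡ + (m ∸ n)
  pos-difference {m} {n} n≤m = trans (ℤP.[+m]-[+n]≡m⊖n m n) (ℤP.⊖-≥ n≤m)

  differences-cancel : ∀ (a b : ℤ) → + 0 ≡ (a ℤ.- b) ℤ.+ (b ℤ.- a)
  differences-cancel = solve-∀ℤ

  0≤difference+pos⇒≤ : ∀ {a b c} → + 0 ℤ.≤ (+ a ℤ.- + b) ℤ.+ + c → b ≤ a + c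
  0≤difference+pos⇒≤ {a} {b} {c} 0≤ =
    ℤP.drop‿+≤+ (subst₂ ℤ._≤_ (ℤP.+-identityʳ (+ b)) sum≡ (ℤP.+-monoʳ-≤ (+ b) 0≤))
    where
    sum≡ : + b ℤ.+ ((+ a ℤ.- + b) ℤ.+ + c) ≡ + (a + c)
    sum≡ = trans (add-difference (+ a) (+ b) (+ c)) (sym (pos-+ a c))

  diagonalThrough⇒SameDiagonal : ∀ {e c} → diagonalThrough e ≡ diagonalThrough c → SameDiagonal c e
  diagonalThrough⇒SameDiagonal {a , b} {r , s} eq = sameDiagonal (pos-+-injective s a b r (begin
    + s ℤ.+ + a                                             ≡⟨ index-split (+ a) (+ b) (+ s) ⟩
    ((+ a ℤ.- + b) ℤ.+ + 1) ℤ.+ ((+ s ℤ.+ + b) ℤ.- + 1) ≡⟨ cong (ℤ._+ ((+ s ℤ.+ + b) ℤ.- + 1)) eq ⟩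
    ((+ r ℤ.- + s) ℤ.+ + 1) ℤ.+ ((+ s ℤ.+ + b) ℤ.- + 1) ≡⟨ index-join (+ r) (+ s) (+ b) ⟩
    + b ℤ.+ + r                                             ∎))
    where open ≡.≡-Reasoning

  SameDiagonal⇒diagonalThrough : ∀ {e c} → SameDiagonal c e → diagonalThrough e ≡ diagonalThrough c
  SameDiagonal⇒diagonalThrough {a , b} {r , s} (sameDiagonal eq) = begin
    (+ a ℤ.- + b) ℤ.+ + 1                             ≡⟨ index-widen (+ a) (+ b) (+ s) ⟩
    ((+ s ℤ.+ + a) ℤ.- (+ s ℤ.+ + b)) ℤ.+ + 1
      ≡⟨ cong (λ z → (z ℤ.- (+ s ℤ.+ + b)) ℤ.+ + 1) (pos-+-≡ s a b r eq) ⟩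
    ((+ b ℤ.+ + r) ℤ.- (+ s ℤ.+ + b)) ℤ.+ + 1         ≡⟨ index-narrow (+ b) (+ r) (+ s) ⟩
    (+ r ℤ.- + s) ℤ.+ + 1                             ∎
    where open ≡.≡-Reasoning

  Initial : List Cell → Cell → Set
  Initial g c = ∀ {d} → d ∈ g → row c ≤ row d × col d ≤ col c

  Initial-unique : ∀ {g c d} → c ∈ g → d ∈ g → Initial g c → Initial g d → c ≡ d
  Initial-unique c∈g d∈g c-initial d-initial =
    cong₂ _,_ (≤-antisym (proj₁ (c-initial d∈g)) (proj₁ (d-initial c∈g)))
              (≤-antisym (proj₂ (d-initial c∈g)) (proj₂ (c-initial d∈g)))

  ¬Initial⇒north-or-east : ∀ {g z} → ¬ Initial g z → ∃ λ w → w ∈ g × (row w < row z ⊎ col z < col w)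
  ¬Initial⇒north-or-east {g} {z} not-initial
    with find (¬All⇒Any¬ (λ w → (row z ≤? row w) ×-dec (col w ≤? col z)) g (not-initial ∘ All.lookup))
  ... | w , w∈g , not-southwest with row z ≤? row w
  ...   | yes z≤w = w , w∈g , inj₂ (ℕ.≰⇒> (λ w≤z → not-southwest (z≤w , w≤z)))
  ...   | no  z≰w = w , w∈g , inj₁ (ℕ.≰⇒> z≰w)

  ≤ᵇ-∧-≤ᵇ⇒ : ∀ {a b c d} → T ((a ≤ᵇ b) ∧ (c ≤ᵇ d)) → a ≤ b × c ≤ d
  ≤ᵇ-∧-≤ᵇ⇒ {a} {b} {c} {d} t = let (t₁ , t₂) = Equivalence.to T-∧ t in ≤ᵇ⇒≤ a b t₁ , ≤ᵇ⇒≤ c d t₂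

  ⇒≤ᵇ-∧-≤ᵇ : ∀ {a b c d} → a ≤ b × c ≤ d → T ((a ≤ᵇ b) ∧ (c ≤ᵇ d))
  ⇒≤ᵇ-∧-≤ᵇ (a≤b , c≤d) = Equivalence.from T-∧ (≤⇒≤ᵇ a≤b , ≤⇒≤ᵇ c≤d)

  isInitialᵇ⇒Initial : ∀ {g c} → T (isInitialᵇ g c) → Initial g c
  isInitialᵇ⇒Initial {g} t d∈g = ≤ᵇ-∧-≤ᵇ⇒ (All.lookup (all⁺ _ g t) d∈g)

  Initial⇒isInitialᵇ : ∀ {g c} → Initial g c → T (isInitialᵇ g c)
  Initial⇒isInitialᵇ initial = all⁻ _ (All.tabulate (⇒≤ᵇ-∧-≤ᵇ ∘ initial))

  isTerminalᵇ⇒ : ∀ {g c d} → T (isTerminalᵇ g c) → d ∈ g → row d ≤ row c × col c ≤ col d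
  isTerminalᵇ⇒ {g} t d∈g = ≤ᵇ-∧-≤ᵇ⇒ (All.lookup (all⁺ _ g t) d∈g)

  ⇒isTerminalᵇ : ∀ {g c} → (∀ {d} → d ∈ g → row d ≤ row c × col c ≤ col d) → T (isTerminalᵇ g c)
  ⇒isTerminalᵇ bounds = all⁻ _ (All.tabulate (⇒≤ᵇ-∧-≤ᵇ ∘ bounds))

  onDiagonalᵇ⇒SameDiagonal : ∀ {e c} → T (onDiagonalᵇ (diagonalThrough e) c) → SameDiagonal c e
  onDiagonalᵇ⇒SameDiagonal {e} {c} t with diagonalThrough e ℤP.≟ diagonalThrough c
  ... | yes eq = diagonalThrough⇒SameDiagonal {e} {c} eq

  SameDiagonal⇒onDiagonalᵇ : ∀ {e c} → SameDiagonal c e → T (onDiagonalᵇ (diagonalThrough e) c)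
  SameDiagonal⇒onDiagonalᵇ {e} {c} same with diagonalThrough e ℤP.≟ diagonalThrough c
  ... | yes _  = tt
  ... | no neq = neq (SameDiagonal⇒diagonalThrough {e} {c} same)

  InitialOnDiagonal : List Cell → Cell → Set
  InitialOnDiagonal g e = ∃ λ c → c ∈ g × Initial g c × SameDiagonal c e

  hasInitialOnᵇ⇒ : ∀ {e g} → T (hasInitialOnᵇ (diagonalThrough e) g) → InitialOnDiagonal g e
  hasInitialOnᵇ⇒ {e} {g} t =
    let (c , c∈g , initial∧on) = find (any⁻ _ g t)
        (initial , on) = Equivalence.to T-∧ initial∧on
    in c , c∈g , isInitialᵇ⇒Initial initial , onDiagonalᵇ⇒SameDiagonal {e} {c} on

  ⇒hasInitialOnᵇ : ∀ {e g} → InitialOnDiagonal g e → T (hasInitialOnᵇ (diagonalThrough e) g)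
  ⇒hasInitialOnᵇ {e} (c , c∈g , initial , same) =
    any⁺ _ (lose c∈g (Equivalence.from T-∧ (Initial⇒isInitialᵇ initial , SameDiagonal⇒onDiagonalᵇ {e} {c} same)))

  hookOn-just : ∀ {e g} R → hookOn (diagonalThrough e) R ≡ just g → g ∈ R × InitialOnDiagonal g e
  hookOn-just {e} (h ∷ R) eq with hasInitialOnᵇ (diagonalThrough e) h in has
  hookOn-just {e} (h ∷ R) refl | true  = here refl , hasInitialOnᵇ⇒ {e} (≡.subst T (sym has) tt)
  ... | false = let (g∈R , initialOn) = hookOn-just R eq in there g∈R , initialOn

  hookOn-nothing : ∀ {e g} R → hookOn (diagonalThrough e) R ≡ nothing → g ∈ R → ¬ InitialOnDiagonal g e
  hookOn-nothing {e} (h ∷ R) eq g∈R initialOn with hasInitialOnᵇ (diagonalThrough e) h in has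
  hookOn-nothing {e} (h ∷ R) () g∈R           initialOn | true
  hookOn-nothing {e} (h ∷ R) eq (here refl)   initialOn | false = ≡.subst T has (⇒hasInitialOnᵇ {e} initialOn)
  hookOn-nothing {e} (h ∷ R) eq (there g∈R)   initialOn | false = hookOn-nothing R eq g∈R initialOn

  hookOn-here : ∀ {e g} R → InitialOnDiagonal g e → hookOn (diagonalThrough e) (g ∷ R) ≡ just g
  hookOn-here {e} {g} R initialOn with hasInitialOnᵇ (diagonalThrough e) g | ⇒hasInitialOnᵇ {e} initialOn
  ... | true | _ = refl

  hookOn-there : ∀ {e g} R → ¬ InitialOnDiagonal g e → hookOn (diagonalThrough e) (g ∷ R) ≡ hookOn (diagonalThrough e) R
  hookOn-there {e} {g} R no-initial with hasInitialOnᵇ (diagonalThrough e) g in has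
  ... | true  = ⊥-elim (no-initial (hasInitialOnᵇ⇒ {e} (≡.subst T (sym has) tt)))
  ... | false = refl

  hookOn-absent : ∀ {e} R → (∀ {g c} → g ∈ R → c ∈ g → ¬ SameDiagonal c e) → hookOn (diagonalThrough e) R ≡ nothing
  hookOn-absent         []      _       = refl
  hookOn-absent {e} (g ∷ R) off-diagonal =
    trans (hookOn-there R (λ (_ , c∈g , _ , same) → off-diagonal (here refl) c∈g same))
          (hookOn-absent R (off-diagonal ∘ there))

  -- `terminalRow` scans with a `where`-bound function that cannot be named from outside Defs;
  -- unifying with the unfolding of `terminalRow (c ∷ cs)` makes `terminalScan` that function.
  mutual
    terminalScan : List Cell → List Cell → Maybe ℕ
    terminalScan = _

    terminalRow-unfold : ∀ c cs →
      terminalRow (c ∷ cs) ≡ (if isTerminalᵇ (c ∷ cs) c then just (row c) else terminalScan (c ∷ cs) cs)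
    terminalRow-unfold c cs with c ∷ cs
    ... | _ = refl

  terminalRow-≡ : ∀ {g t} → (t , 1) ∈ g → (∀ {c} → c ∈ g → row c ≤ t × 1 ≤ col c) → terminalRow g ≡ just t
  terminalRow-≡ {c ∷ cs} {t} t∈g bounds = trans (terminalRow-unfold c cs) (scan (c ∷ cs) t∈g id)
    where
    g = c ∷ cs
    scan : ∀ ds → (t , 1) ∈ ds → (∀ {d} → d ∈ ds → d ∈ g) → terminalScan g ds ≡ just t
    scan (d ∷ ds) t∈ ds⊆g with isTerminalᵇ g d in terminal
    ... | true  = cong just (≤-antisym (proj₁ (bounds (ds⊆g (here refl))))
                                       (proj₁ (isTerminalᵇ⇒ {g} {d} (≡.subst T (sym terminal) tt) t∈g)))
    ... | false with t∈
    ...   | here refl  = ⊥-elim (≡.subst T terminal (⇒isTerminalᵇ {g} {d} bounds))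
    ...   | there t∈ds = scan ds t∈ds (ds⊆g ∘ there)

  module _ (μ : List ℕ) (R : List (List Cell)) (x : ℕ) where

    permSRT-hookless : hookOn (diagIndex μ x) R ≡ nothing → permSRT μ R x ≡ + x ℤ.- + part μ x
    permSRT-hookless eq with hookOn (diagIndex μ x) R
    permSRT-hookless refl | nothing = refl

    permSRT-hooked : ∀ {g t} → hookOn (diagIndex μ x) R ≡ just g → terminalRow g ≡ just t → permSRT μ R x ≡ + t
    permSRT-hooked eq₁ eq₂ with hookOn (diagIndex μ x) R
    permSRT-hooked {g} refl eq₂ | just .g with terminalRow g
    permSRT-hooked     refl refl | just _ | just _ = refl

    Γ-hookless : hookOn (diagIndex μ x) R ≡ nothing → Γ μ R x ≡ 0
    Γ-hookless eq with hookOn (diagIndex μ x) R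
    Γ-hookless refl | nothing = refl

    Γ-hooked : ∀ {g} → hookOn (diagIndex μ x) R ≡ just g → Γ μ R x ≡ length g
    Γ-hooked eq with hookOn (diagIndex μ x) R
    Γ-hooked refl | just _ = refl

  -- Rim hooks

  Terminal : List Cell → ℕ → Set
  Terminal g t = (t , 1) ∈ g × (∀ {c} → c ∈ g → row c ≤ t)

  module RimHook {g : List Cell} (skew : IsSkewDiagram g) where

    private
      μ = proj₁ skew
      ν = proj₁ (proj₂ skew)
      μ-antitone = part-antitone (proj₁ (proj₁ (proj₂ (proj₂ skew))))
      ν-antitone = part-antitone (proj₁ (proj₁ (proj₂ (proj₂ (proj₂ skew)))))
      membership = proj₂ (proj₂ (proj₂ (proj₂ (proj₂ skew))))

    cell-positive : ∀ {c} → c ∈ g → 1 ≤ row c × 1 ≤ col c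
    cell-positive {c} c∈g = let (1≤i , 1≤j , _) = proj₁ (proj₁ (membership c) c∈g) in 1≤i , 1≤j

    convex : ∀ {i j i′ j′ x y} → (i , j) ∈ g → (i′ , j′) ∈ g →
      i ≤ x → x ≤ i′ → j ≤ y → y ≤ j′ → (x , y) ∈ g
    convex {i} {j} {i′} {j′} {x} {y} ij∈g ij′∈g i≤x x≤i′ j≤y y≤j′ = proj₂ (membership (x , y)) (in-μ , not-in-ν)
      where
      ij  = proj₁ (membership (i , j)) ij∈g
      ij′ = proj₁ (membership (i′ , j′)) ij′∈g
      1≤i = proj₁ (proj₁ ij)
      1≤j = proj₁ (proj₂ (proj₁ ij))
      1≤x = ≤-trans 1≤i i≤x
      in-μ : InDiagram μ (x , y)
      in-μ = 1≤x , ≤-trans 1≤j j≤y , ≤-trans y≤j′ (≤-trans (proj₂ (proj₂ (proj₁ ij′))) (μ-antitone 1≤x x≤i′))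
      not-in-ν : ¬ InDiagram ν (x , y)
      not-in-ν (_ , _ , y≤νx) = proj₂ ij (1≤i , 1≤j , ≤-trans j≤y (≤-trans y≤νx (ν-antitone 1≤i i≤x)))

    row-path : ∀ {x y y′} → (x , y′) ∈ g → (x , y) ∈ g → y′ ≤ y → PathIn g (x , y) (x , y′)
    row-path {y = zero}  _     _   z≤n = here
    row-path {y = suc y} start end y′≤1+y with ℕ.m≤n⇒m<n∨m≡n y′≤1+y
    ... | inj₂ refl       = here
    ... | inj₁ (s≤s y′≤y) = step west middle (row-path start middle y′≤y)
      where middle = convex start end ≤-refl ≤-refl y′≤y (n≤1+n y)

    module _ (no2x2 : No2x2 g) where

      no-southeast-pair : ∀ {x y x′ y′} → (x′ , y′) ∈ g → (x , y) ∈ g → x′ < x → y′ < y → ⊥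
      no-southeast-pair {suc x} {suc y} nw∈g se∈g (s≤s x′≤x) (s≤s y′≤y) =
        no2x2 x y ( convex nw∈g se∈g x′≤x (n≤1+n x) y′≤y (n≤1+n y)
                  , convex nw∈g se∈g (m≤n⇒m≤1+n x′≤x) ≤-refl y′≤y (n≤1+n y)
                  , convex nw∈g se∈g x′≤x (n≤1+n x) (m≤n⇒m≤1+n y′≤y) ≤-refl
                  , se∈g )

      SameDiagonal⇒≡ : ∀ {c d} → c ∈ g → d ∈ g → SameDiagonal c d → c ≡ d
      SameDiagonal⇒≡ {i , j} {i′ , j′} c∈g d∈g (sameDiagonal same) with ℕ.<-cmp i i′
      ... | tri≈ _ refl _ = cong (i ,_) (ℕ.+-cancelʳ-≡ i j j′ same)
      ... | tri< i<i′ _ _ = ⊥-elim (no-southeast-pair c∈g d∈g i<i′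
              (ℕ.+-cancelʳ-< i j j′ (ℕ.<-≤-trans (ℕ.+-monoʳ-< j i<i′) (ℕ.≤-reflexive same))))
      ... | tri> _ _ i>i′ = ⊥-elim (no-southeast-pair d∈g c∈g i>i′
              (ℕ.+-cancelʳ-< i′ j′ j (ℕ.<-≤-trans (ℕ.+-monoʳ-< j′ i>i′) (ℕ.≤-reflexive (sym same)))))

    terminal-exists : ∀ {r₀} → (r₀ , 1) ∈ g → ∃ (Terminal g)
    terminal-exists {r₀} r₀∈g = row lowest , lowest-first-column , All.lookup (f[xs]≤f[argmax] {f = row} (r₀ , 1) g)
      where
      open Data.List.Extrema ℕ.≤-totalOrder using (argmax; argmax-all; f[xs]≤f[argmax]; f[⊥]≤f[argmax])
      lowest = argmax row (r₀ , 1) g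
      lowest∈g : lowest ∈ g
      lowest∈g = argmax-all row {P = _∈ g} r₀∈g (All.tabulate id)
      lowest-first-column : (row lowest , 1) ∈ g
      lowest-first-column =
        convex r₀∈g lowest∈g (f[⊥]≤f[argmax] {f = row} (r₀ , 1) g) ≤-refl ≤-refl (proj₂ (cell-positive lowest∈g))

    terminalRow-Terminal : ∀ {t} → Terminal g t → terminalRow g ≡ just t
    terminalRow-Terminal (t∈g , below) = terminalRow-≡ t∈g (λ c∈g → below c∈g , proj₂ (cell-positive c∈g))

    module _ (no2x2 : No2x2 g) (connected : Connected g) {t} (terminal : Terminal g t) where

      private
        below = proj₂ terminal

      next-diagonal : ∀ {z} → z ∈ g → ¬ Initial g z → ∃ λ w → w ∈ g × NextDiagonal z w
      next-diagonal {z} z∈g not-initial with ¬Initial⇒north-or-east not-initial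
      ... | w₀ , w₀∈g , escape with shiftedContent t z <? shiftedContent t w₀
      ... | yes z<w₀ =
        let (w , w∈g , w≡) = path-intermediate-value (shiftedContent t) (shiftedContent-adjacent t)
                               z∈g (connected z w₀ z∈g w₀∈g) (n≤1+n _) z<w₀
        in w , w∈g , nextDiagonal (∸-cross-≡ (below w∈g) (below z∈g) w≡)
      ... | no z≮w₀ with ∸-cross-≤ (below w₀∈g) (below z∈g) (≮⇒≥ z≮w₀) | escape
      ...   | le | inj₁ w₀-above = ⊥-elim (no-southeast-pair no2x2 w₀∈g z∈g w₀-above
                (ℕ.+-cancelʳ-< (row z) (col w₀) (col z) (ℕ.≤-<-trans le (ℕ.+-monoʳ-< (col z) w₀-above))))
      ...   | le | inj₂ w₀-right = ⊥-elim (no-southeast-pair no2x2 z∈g w₀∈g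
                (ℕ.+-cancelˡ-< (col w₀) (row z) (row w₀) (ℕ.≤-<-trans le (ℕ.+-monoˡ-< (row w₀) w₀-right))) w₀-right)

      hook-length : Unique g → ∀ {a b} → (a , b) ∈ g → Initial g (a , b) → length g + a ≡ b + t
      hook-length unique {a} {b} ab∈g initial = begin
        length g + a        ≡⟨ cong (_+ a) counted ⟩
        b + (t ∸ a) + a     ≡⟨ ℕ.+-assoc b (t ∸ a) a ⟩
        b + ((t ∸ a) + a)   ≡⟨ cong (λ z → b + z) (ℕ.m∸n+n≡m (below ab∈g)) ⟩
        b + t               ∎
        where
        open ≡.≡-Reasoning
        start : shiftedContent t (t , 1) ≡ 1
        start = cong suc (ℕ.n∸n≡0 t)
        counted : length g ≡ b + (t ∸ a)
        counted = length-by-labelling (shiftedContent t) unique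
          (λ {c} c∈g → ≤-trans (proj₂ (cell-positive c∈g)) (ℕ.m≤m+n (col c) _)
                     , ℕ.+-mono-≤ (proj₂ (initial c∈g)) (ℕ.∸-monoʳ-≤ t (proj₁ (initial c∈g))))
          (λ c∈g d∈g eq → SameDiagonal⇒≡ no2x2 c∈g d∈g (sameDiagonal (∸-cross-≡ (below c∈g) (below d∈g) eq)))
          (λ {k} 1≤k k≤n → path-intermediate-value (shiftedContent t) (shiftedContent-adjacent t)
                         (proj₁ terminal) (connected _ _ (proj₁ terminal) ab∈g) (subst (_≤ k) (sym start) 1≤k) k≤n)

  -- Special rim hook tableaux

  module Tableau {μ : List ℕ} (partition : IsPartition μ) {R : List (List Cell)} (srt : IsSRT μ R) where

    open IsSRT srt
    open ≡.≡-Reasoning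

    private
      p = part μ
      ℓ = length μ
      antitone = part-antitone (proj₁ partition)
      skew = λ {g} (g∈R : g ∈ R) → proj₁ (rimHooks g g∈R)
      connected = λ {g} (g∈R : g ∈ R) → proj₁ (proj₂ (rimHooks g g∈R))
      no2x2 = λ {g} (g∈R : g ∈ R) → proj₂ (proj₂ (rimHooks g g∈R))

    rowEnd : ℕ → Cell
    rowEnd x = x , p x

    same-hook : ∀ {g g′ c} → g ∈ R → g′ ∈ R → c ∈ g → c ∈ g′ → g ≡ g′
    same-hook = Unique-concat⇒≡ disjoint

    hook-terminal : ∀ {g} → g ∈ R → ∃ (Terminal g)
    hook-terminal {g} g∈R with firstColumn g g∈R
    ... | (r₀ , _) , c∈g , refl = RimHook.terminal-exists (skew g∈R) c∈g

    hook-next-diagonal : ∀ {g z} → g ∈ R → z ∈ g → ¬ Initial g z → ∃ λ w → w ∈ g × NextDiagonal z w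
    hook-next-diagonal g∈R = RimHook.next-diagonal (skew g∈R) (no2x2 g∈R) (connected g∈R) (proj₂ (hook-terminal g∈R))

    Γ-formula : ∀ x → + Γ μ R x ≡ (+ p x ℤ.- + x) ℤ.+ permSRT μ R x
    Γ-formula x = by-hook (hookOn (diagIndex μ x) R) refl
      where
      by-hook : ∀ m → hookOn (diagIndex μ x) R ≡ m → + Γ μ R x ≡ (+ p x ℤ.- + x) ℤ.+ permSRT μ R x
      by-hook nothing hook rewrite Γ-hookless μ R x hook | permSRT-hookless μ R x hook =
        differences-cancel (+ p x) (+ x)
      by-hook (just g) hook with hookOn-just {rowEnd x} R hook
      ... | g∈R , (a , b) , ab∈g , initial , ab~x with hook-terminal g∈R
      ...   | t , terminal
        rewrite Γ-hooked μ R x hook | permSRT-hooked μ R x hook (RimHook.terminalRow-Terminal (skew g∈R) terminal) =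
        pos≡difference+pos {x = x} {y = p x} (+-exchange {length g} {a} {b} {t} {x} {p x} length-g (SameDiagonal.balanced ab~x))
        where
        length-g : length g + a ≡ b + t
        length-g = RimHook.hook-length (skew g∈R) (no2x2 g∈R) (connected g∈R) terminal
                                       (Unique-concat⁻ disjoint g∈R) ab∈g initial

    diagonal-in-diagram : ∀ {x c} → SameDiagonal c (rowEnd x) → 1 ≤ row c → 1 ≤ col c → row c ≤ x → InDiagram μ c
    diagonal-in-diagram {x} {c} (sameDiagonal c~x) 1≤r 1≤s r≤x =
      1≤r , 1≤s , ≤-trans (ℕ.+-cancelʳ-≤ (row c) (col c) (p x) (≤-trans (ℕ.+-monoʳ-≤ (col c) r≤x) (ℕ.≤-reflexive c~x)))
                          (antitone 1≤r r≤x)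

    next-diagonal-above : ∀ {x w} → 1 ≤ x → InDiagram μ w → NextDiagonal (rowEnd x) w → row w < x
    next-diagonal-above {x} {w} 1≤x (_ , _ , s≤) (nextDiagonal x→w) =
      ℕ.≰⇒> λ x≤r → <-irrefl refl (ℕ.<-≤-trans (beyond x≤r) (≤-trans s≤ (antitone 1≤x x≤r)))
      where
      beyond : x ≤ row w → p x < col w
      beyond x≤r = ℕ.+-cancelʳ-≤ x _ _ (≤-trans (s≤s (ℕ.+-monoʳ-≤ (p x) x≤r)) (ℕ.≤-reflexive (sym x→w)))

    hookless-continues : ∀ {x c} → hookOn (diagIndex μ x) R ≡ nothing → InDiagram μ c → SameDiagonal c (rowEnd x) →
      ∃ λ g → g ∈ R × c ∈ g × ∃ λ w → w ∈ g × NextDiagonal (rowEnd x) w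
    hookless-continues {x} {c} hookless c-in c~x with covers c c-in
    ... | g , g∈R , c∈g
      with hook-next-diagonal g∈R c∈g (λ initial → hookOn-nothing {rowEnd x} R hookless g∈R (c , c∈g , initial , c~x))
    ...   | w , w∈g , c→w = g , g∈R , c∈g , w , w∈g , NextDiagonal-respˡ c~x c→w

    -- The cells of the diagonal in rows a … x continue, inside their hooks, to distinct cells of
    -- the next diagonal, which lie above row x; so they cannot all stay in rows a … x − 1.
    hookless-diagonal-escapes : ∀ {x a b} → hookOn (diagIndex μ x) R ≡ nothing →
      SameDiagonal (a , b) (rowEnd x) → 1 ≤ a → 1 ≤ b → a ≤ x →
      (∀ {g c w} → g ∈ R → c ∈ g → w ∈ g → a ≤ row c → NextDiagonal (rowEnd x) w → a ≤ row w) → ⊥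
    hookless-diagonal-escapes {x} {a} {b} hookless ab~x 1≤a 1≤b a≤x stays = pigeonhole-ℕ (x ∸ a) Rel partner functional
      where
      Rel : ℕ → ℕ → Set
      Rel i j = ∃ λ g → g ∈ R × (a + i , b + i) ∈ g × (a + j , suc (b + j)) ∈ g

      on-diagonal : ∀ i → SameDiagonal (a + i , b + i) (rowEnd x)
      on-diagonal i = SameDiagonal-trans (SameDiagonal-shift a b i) ab~x

      in-diagram : ∀ {i} → i ≤ x ∸ a → InDiagram μ (a + i , b + i)
      in-diagram {i} i≤n = diagonal-in-diagram (on-diagonal i) (≤-trans 1≤a (ℕ.m≤m+n a i)) (≤-trans 1≤b (ℕ.m≤m+n b i))
                             (≤-trans (ℕ.+-monoʳ-≤ a i≤n) (ℕ.≤-reflexive (ℕ.m+[n∸m]≡n a≤x)))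

      partner : ∀ {i} → i ≤ x ∸ a → ∃ λ j → j < x ∸ a × Rel i j
      partner {i} i≤n = from-continuation (hookless-continues hookless (in-diagram i≤n) (on-diagonal i))
        where
        from-continuation : (∃ λ g → g ∈ R × (a + i , b + i) ∈ g × ∃ λ w → w ∈ g × NextDiagonal (rowEnd x) w) →
                            ∃ λ j → j < x ∸ a × Rel i j
        from-continuation (g , g∈R , c∈g , w , w∈g , x→w) =
          row w ∸ a , ℕ.∸-monoˡ-< (next-diagonal-above (≤-trans 1≤a a≤x) (inside g w g∈R w∈g) x→w) a≤w ,
          g , g∈R , c∈g , subst (_∈ g) (NextDiagonal-offset a≤w (NextDiagonal-respˡ (SameDiagonal-sym ab~x) x→w)) w∈g
          where
          a≤w : a ≤ row w
          a≤w = stays g∈R c∈g w∈g (ℕ.m≤m+n a i) x→w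

      functional : ∀ {i i′ j} → Rel i j → Rel i′ j → i ≡ i′
      functional {i} {i′} (g , g∈R , c∈g , w∈g) (g′ , g′∈R , c′∈g′ , w∈g′) with same-hook g∈R g′∈R w∈g w∈g′
      ... | refl = ℕ.+-cancelˡ-≡ a i i′ (cong row (RimHook.SameDiagonal⇒≡ (skew g∈R) (no2x2 g∈R) c∈g c′∈g′
                     (SameDiagonal-trans (SameDiagonal-shift a b i) (SameDiagonal-sym (SameDiagonal-shift a b i′)))))

    hookless⇒short-row : ∀ {x} → hookOn (diagIndex μ x) R ≡ nothing → 1 ≤ x → p x < x
    hookless⇒short-row {x} hookless 1≤x = ℕ.≰⇒> λ x≤px →
      hookless-diagonal-escapes hookless (top x≤px) ≤-refl (s≤s z≤n) 1≤x (λ g∈R _ w∈g _ _ → proj₁ (inside _ _ g∈R w∈g))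
      where
      top : x ≤ p x → SameDiagonal (1 , suc (p x ∸ x)) (rowEnd x)
      top x≤px = sameDiagonal (trans (cong suc (ℕ.m∸n+n≡m x≤px)) (ℕ.+-comm 1 (p x)))

    hookless-value≢terminal : ∀ {y g t} → hookOn (diagIndex μ y) R ≡ nothing → g ∈ R → Terminal g t →
      t + p y ≡ y → 1 ≤ y → y ≤ ℓ → ⊥
    hookless-value≢terminal {y} {g} {t} hookless g∈R (t∈g , below) t+py≡y 1≤y y≤ℓ =
      hookless-diagonal-escapes hookless top (s≤s z≤n) ≤-refl t<y stays-below-terminal
      where
      top : SameDiagonal (suc t , 1) (rowEnd y)
      top = sameDiagonal (trans (cong suc (trans (sym t+py≡y) (ℕ.+-comm t (p y)))) (sym (ℕ.+-suc (p y) t)))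
      t<y : suc t ≤ y
      t<y = subst (suc t ≤_) t+py≡y
              (subst (_≤ t + p y) (ℕ.+-comm t 1) (ℕ.+-monoʳ-≤ t (part-positive (proj₂ partition) 1≤y y≤ℓ)))
      stays-below-terminal : ∀ {g′ c w} → g′ ∈ R → c ∈ g′ → w ∈ g′ →
        suc t ≤ row c → NextDiagonal (rowEnd y) w → suc t ≤ row w
      stays-below-terminal {g′} {c} {w} g′∈R c∈g′ w∈g′ t<c y→w = ℕ.≰⇒> λ w≤t →
        <-irrefl refl (ℕ.<-≤-trans t<c (below (subst (c ∈_) (g′≡g w≤t) c∈g′)))
        where
        g′≡g : row w ≤ t → g′ ≡ g
        g′≡g w≤t = same-hook g′∈R g∈R (subst (_∈ g′) w≡t1 w∈g′) t∈g
          where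
          w≡t1 = NextDiagonal-corner (NextDiagonal-respˡ (SameDiagonal-sym top) y→w)
                                     (proj₁ (proj₂ (inside _ _ g′∈R w∈g′))) w≤t

    PermReading : ℕ → ℕ → Set
    PermReading x v = (∃ λ g → g ∈ R × hookOn (diagIndex μ x) R ≡ just g × Terminal g v)
                   ⊎ (hookOn (diagIndex μ x) R ≡ nothing × v + p x ≡ x)

    permSRT-value : ∀ {x} → 1 ≤ x → x ≤ ℓ → ∃ λ v → permSRT μ R x ≡ + v × 1 ≤ v × v ≤ ℓ × PermReading x v
    permSRT-value {x} 1≤x x≤ℓ = by-hook (hookOn (diagIndex μ x) R) refl
      where
      by-hook : ∀ m → hookOn (diagIndex μ x) R ≡ m → ∃ λ v → permSRT μ R x ≡ + v × 1 ≤ v × v ≤ ℓ × PermReading x v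
      by-hook (just g) hook with hookOn-just {rowEnd x} R hook
      ... | g∈R , _ with hook-terminal g∈R
      ...   | t , terminal@(t∈g , _) =
        t , permSRT-hooked μ R x hook (RimHook.terminalRow-Terminal (skew g∈R) terminal) ,
        proj₁ (inside _ _ g∈R t∈g) , inShape-row≤ (part-vanishes μ) (inside _ _ g∈R t∈g) , inj₁ (g , g∈R , hook , terminal)
      by-hook nothing hook =
        x ∸ p x , trans (permSRT-hookless μ R x hook) (pos-difference (ℕ.<⇒≤ short)) ,
        ℕ.m<n⇒0<n∸m short , ≤-trans (ℕ.m∸n≤m x (p x)) x≤ℓ , inj₂ (hook , ℕ.m∸n+n≡m (ℕ.<⇒≤ short))
        where short = hookless⇒short-row hook 1≤x

    PermReading-injective : ∀ {x y v} → 1 ≤ x → x ≤ ℓ → 1 ≤ y → y ≤ ℓ →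
      PermReading x v → PermReading y v → x ≡ y
    PermReading-injective {x} {y} 1≤x _ 1≤y _ (inj₁ (g , g∈R , hx , v∈g , _)) (inj₁ (g′ , g′∈R , hy , v∈g′ , _))
      with same-hook g∈R g′∈R v∈g v∈g′
    ... | refl with hookOn-just {rowEnd x} R hx | hookOn-just {rowEnd y} R hy
    ...   | _ , c , c∈g , c-initial , c~x | _ , d , d∈g , d-initial , d~y with Initial-unique c∈g d∈g c-initial d-initial
    ...     | refl = rowEnd-injective antitone 1≤x 1≤y (SameDiagonal-trans (SameDiagonal-sym c~x) d~y)
    PermReading-injective {x} {y} {v} 1≤x _ 1≤y _ (inj₂ (_ , v+px≡x)) (inj₂ (_ , v+py≡y)) =
      rowEnd-injective antitone 1≤x 1≤y (sameDiagonal (begin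
        p x + y         ≡⟨ cong (λ z → p x + z) (sym v+py≡y) ⟩
        p x + (v + p y) ≡⟨ swap-inner (p x) v (p y) ⟩
        p y + (v + p x) ≡⟨ cong (λ z → p y + z) v+px≡x ⟩
        p y + x         ∎))
      where
      swap-inner : ∀ a b c → a + (b + c) ≡ c + (b + a)
      swap-inner = solve-∀
    PermReading-injective _ _ 1≤y y≤ℓ (inj₁ (_ , g∈R , _ , terminal)) (inj₂ (hy , v+py≡y)) =
      ⊥-elim (hookless-value≢terminal hy g∈R terminal v+py≡y 1≤y y≤ℓ)
    PermReading-injective 1≤x x≤ℓ _ _ (inj₂ (hx , v+px≡x)) (inj₁ (_ , g∈R , _ , terminal)) =
      ⊥-elim (hookless-value≢terminal hx g∈R terminal v+px≡x 1≤x x≤ℓ)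

    permSRT-permutation : Σ (Permutation′ ℓ) λ σ → ∀ i → permSRT μ R (pos i) ≡ + pos (σ ⟨$⟩ʳ i)
    permSRT-permutation =
      σ , λ i → trans (proj₁ (proj₂ (value i))) (cong +_ (sym (trans (cong pos (σ≡f i)) (pos-f i))))
      where
      value : (i : Fin ℓ) → ∃ λ v → permSRT μ R (pos i) ≡ + v × 1 ≤ v × v ≤ ℓ × PermReading (pos i) v
      value i = permSRT-value (s≤s z≤n) (toℕ<n i)
      f : Fin ℓ → Fin ℓ
      f i = let (_ , _ , 1≤v , v≤ℓ , _) = value i in toFin 1≤v v≤ℓ
      pos-f : ∀ i → pos (f i) ≡ proj₁ (value i)
      pos-f i = let (_ , _ , 1≤v , v≤ℓ , _) = value i in pos-toFin 1≤v v≤ℓ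
      f-injective : ∀ {i j} → f i ≡ f j → i ≡ j
      f-injective {i} {j} fi≡fj = toℕ-injective (ℕ.suc-injective
        (PermReading-injective (s≤s z≤n) (toℕ<n i) (s≤s z≤n) (toℕ<n j)
                               (reading i) (subst (PermReading (pos j)) (sym same-value) (reading j))))
        where
        reading = λ i → proj₂ (proj₂ (proj₂ (proj₂ (value i))))
        same-value : proj₁ (value i) ≡ proj₁ (value j)
        same-value = trans (sym (pos-f i)) (trans (cong pos fi≡fj) (pos-f j))
      σ = proj₁ (injective⇒permutation f f-injective)
      σ≡f = proj₂ (injective⇒permutation f f-injective)

    permSRT-admissible : ∀ x → + 0 ℤ.≤ (+ p x ℤ.- + x) ℤ.+ permSRT μ R x
    permSRT-admissible x = subst (+ 0 ℤ.≤_) (Γ-formula x) (ℤ.+≤+ z≤n)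

  -- Building a tableau from a permutation

  inShape? : (p : ℕ → ℕ) → (c : Cell) → Dec (InShape p c)
  inShape? p (i , j) = (1 ≤? i) ×-dec ((1 ≤? j) ×-dec (j ≤? p i))

  InSkew : (ℕ → ℕ) → (ℕ → ℕ) → Cell → Set
  InSkew p q c = InShape p c × ¬ InShape q c

  inSkew? : (p q : ℕ → ℕ) → (c : Cell) → Dec (InSkew p q c)
  inSkew? p q c = inShape? p c ×-dec ¬? (inShape? q c)

  skewCells : (p q : ℕ → ℕ) → ℕ → List Cell
  skewCells p q L = filter (inSkew? p q) (cartesianProduct (upTo (suc L)) (upTo (suc (p 1))))

  module SkewCells (p q : ℕ → ℕ) (L : ℕ) where

    skewCells-unique : Unique (skewCells p q L)
    skewCells-unique = Unique.filter⁺ (inSkew? p q) (Unique.cartesianProduct⁺ (Unique.upTo⁺ (suc L)) (Unique.upTo⁺ (suc (p 1))))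

    ∈-skewCells⁻ : ∀ {c} → c ∈ skewCells p q L → InSkew p q c
    ∈-skewCells⁻ c∈ = proj₂ (∈-filter⁻ (inSkew? p q) {xs = cartesianProduct (upTo (suc L)) (upTo (suc (p 1)))} c∈)

    ∈-skewCells⁺ : Antitone p → VanishesAbove p L → ∀ {c} → InSkew p q c → c ∈ skewCells p q L
    ∈-skewCells⁺ antitone vanishes {i , j} in-skew@((1≤i , _ , j≤pi) , _) =
      ∈-filter⁺ (inSkew? p q) (∈-cartesianProduct⁺ (∈-upTo⁺ (s≤s (inShape-row≤ vanishes (proj₁ in-skew))))
                                       (∈-upTo⁺ (s≤s (≤-trans j≤pi (antitone ≤-refl 1≤i))))) in-skew

    skewCells-skew : Antitone p → VanishesAbove p L → Antitone q → VanishesAbove q L →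
      (∀ {x} → 1 ≤ x → q x ≤ p x) → IsSkewDiagram (skewCells p q L)
    skewCells-skew p-antitone p-vanishes q-antitone q-vanishes q≤p =
      toPartition p L , toPartition q L ,
      toPartition-isPartition L p-antitone p-vanishes , toPartition-isPartition L q-antitone q-vanishes ,
      contained , λ c → (λ c∈ → let (in-p , not-q) = ∈-skewCells⁻ c∈ in to-μ in-p , not-q ∘ from-ν) ,
                        (λ (in-μ , not-ν) → ∈-skewCells⁺ p-antitone p-vanishes (from-μ in-μ , not-ν ∘ to-ν))
      where
      to-μ   = toPartition-diagram⇐ p-antitone p-vanishes
      from-μ = toPartition-diagram⇒ p-antitone p-vanishes
      to-ν   = toPartition-diagram⇐ q-antitone q-vanishes
      from-ν = toPartition-diagram⇒ q-antitone q-vanishes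
      contained : ∀ k → part (toPartition q L) k ≤ part (toPartition p L) k
      contained zero    = subst₂ _≤_ (sym (part-zero (toPartition q L))) (sym (part-zero (toPartition p L))) z≤n
      contained (suc k) = subst₂ _≤_ (sym (part-toPartition L q-antitone q-vanishes (s≤s z≤n)))
                                     (sym (part-toPartition L p-antitone p-vanishes (s≤s z≤n))) (q≤p (s≤s z≤n))

  -- The ℕ-analogue of Fin.punchIn.
  skip : ℕ → ℕ → ℕ
  skip i x with x <? i
  ... | yes _ = x
  ... | no  _ = suc x

  -- The shape left when the rim hook from (i , p i) down to the last row is removed.
  shrink : (ℕ → ℕ) → ℕ → ℕ → ℕ
  shrink p i x with x <? i
  ... | yes _ = p x
  ... | no  _ = p (suc x) ∸ 1

  private
    ≤-pred-absurd : ∀ {m n} → 1 ≤ m → n ≤ m → m ≤ n ∸ 1 → ⊥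
    ≤-pred-absurd {suc m} {suc n} _ (s≤s n≤m) m<n = <-irrefl refl (≤-trans m<n n≤m)
    ≤-pred-absurd {suc m} {zero}  _ _         ()

    ∸1<⇒≤ : ∀ {m y} → m ∸ 1 < y → m ≤ y
    ∸1<⇒≤ {zero}  _   = z≤n
    ∸1<⇒≤ {suc m} m<y = m<y

    pred-shift : ∀ {m} x → 1 ≤ m → (m ∸ 1) + suc x ≡ m + x
    pred-shift {suc m} x _ = ℕ.+-suc m x

  module _ {i : ℕ} where

    skip-below : ∀ {x} → x < i → skip i x ≡ x
    skip-below {x} x<i with x <? i
    ... | yes _   = refl
    ... | no  x≮i = contradiction x<i x≮i

    skip-above : ∀ {x} → i ≤ x → skip i x ≡ suc x
    skip-above {x} i≤x with x <? i
    ... | yes x<i = contradiction i≤x (ℕ.<⇒≱ x<i)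
    ... | no  _   = refl

    skip-≢ : ∀ x → skip i x ≢ i
    skip-≢ x with x <? i
    ... | yes x<i = λ x≡i → <-irrefl x≡i x<i
    ... | no  x≮i = λ 1+x≡i → x≮i (ℕ.≤-reflexive 1+x≡i)

    skip-injective : ∀ {x y} → skip i x ≡ skip i y → x ≡ y
    skip-injective {x} {y} eq with x <? i | y <? i
    ... | yes _   | yes _   = eq
    ... | no  _   | no  _   = ℕ.suc-injective eq
    ... | yes x<i | no  y≮i = contradiction (ℕ.<-trans (ℕ.≤-reflexive (sym eq)) x<i) y≮i
    ... | no  x≮i | yes y<i = contradiction (ℕ.<-trans (ℕ.≤-reflexive eq) y<i) x≮i

    skip-range : ∀ {x L} → 1 ≤ x → x ≤ L → 1 ≤ skip i x × skip i x ≤ suc L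
    skip-range {x} 1≤x x≤L with x <? i
    ... | yes _ = 1≤x , m≤n⇒m≤1+n x≤L
    ... | no  _ = s≤s z≤n , s≤s x≤L

    skip-onto : ∀ {x L} → 1 ≤ i → i ≤ suc L → x ≢ i → 1 ≤ x → x ≤ suc L →
      ∃ λ x′ → (1 ≤ x′ × x′ ≤ L) × skip i x′ ≡ x
    skip-onto {x} 1≤i i≤1+L x≢i 1≤x _ with ℕ.<-cmp x i
    ... | tri≈ _ x≡i _ = contradiction x≡i x≢i
    ... | tri< x<i _ _ = x , (1≤x , ℕ.s≤s⁻¹ (ℕ.<-≤-trans x<i i≤1+L)) , skip-below x<i
    skip-onto {suc x′} 1≤i _ _ _ (s≤s x′≤L) | tri> _ _ (s≤s i≤x′) =
      x′ , (≤-trans 1≤i i≤x′ , x′≤L) , skip-above i≤x′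

  module RemoveHook {p : ℕ → ℕ} {L′ i : ℕ} (antitone : Antitone p) (vanishes : VanishesAbove p (suc L′))
                    (last-nonempty : 1 ≤ p (suc L′)) (1≤i : 1 ≤ i) (i≤L : i ≤ suc L′) where

    q : ℕ → ℕ
    q = shrink p i

    H : List Cell
    H = skewCells p q (suc L′)

    open SkewCells p q (suc L′)

    nonempty : ∀ {x} → 1 ≤ x → x ≤ suc L′ → 1 ≤ p x
    nonempty 1≤x x≤L = ≤-trans last-nonempty (antitone 1≤x x≤L)

    q-below : ∀ {x} → x < i → q x ≡ p x
    q-below {x} x<i with x <? i
    ... | yes _   = refl
    ... | no  x≮i = contradiction x<i x≮i

    q-above : ∀ {x} → i ≤ x → q x ≡ p (suc x) ∸ 1
    q-above {x} i≤x with x <? i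
    ... | yes x<i = contradiction i≤x (ℕ.<⇒≱ x<i)
    ... | no  _   = refl

    q≤p : ∀ {x} → 1 ≤ x → q x ≤ p x
    q≤p {x} 1≤x with x <? i
    ... | yes _ = ≤-refl
    ... | no  _ = ≤-trans (ℕ.m∸n≤m _ 1) (antitone 1≤x (n≤1+n x))

    q-antitone : Antitone q
    q-antitone = antitone-by-steps one-step
      where
      one-step : ∀ x → 1 ≤ x → q (suc x) ≤ q x
      one-step x 1≤x = by-cases (ℕ.<-≤-connex (suc x) i)
        where
        next-row≤ : p (suc (suc x)) ∸ 1 ≤ p (suc x) ∸ 1
        next-row≤ = ℕ.∸-monoˡ-≤ 1 (antitone (s≤s z≤n) (n≤1+n (suc x)))
        by-cases : suc x < i ⊎ i ≤ suc x → q (suc x) ≤ q x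
        by-cases (inj₁ 1+x<i) =
          subst₂ _≤_ (sym (q-below 1+x<i)) (sym (q-below (ℕ.<-trans (ℕ.n<1+n x) 1+x<i))) (antitone 1≤x (n≤1+n x))
        by-cases (inj₂ i≤1+x) with ℕ.<-≤-connex x i
        ... | inj₁ x<i = subst₂ _≤_ (sym (q-above i≤1+x)) (sym (q-below x<i))
                           (≤-trans next-row≤ (≤-trans (ℕ.m∸n≤m _ 1) (antitone 1≤x (n≤1+n x))))
        ... | inj₂ i≤x = subst₂ _≤_ (sym (q-above i≤1+x)) (sym (q-above i≤x)) next-row≤

    q-vanishes : VanishesAbove q L′
    q-vanishes {x} L′<x = trans (q-above (≤-trans i≤L L′<x)) (cong (_∸ 1) (vanishes (s≤s L′<x)))

    row≥i : ∀ {c} → InSkew p q c → i ≤ row c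
    row≥i {x , y} ((1≤x , 1≤y , y≤px) , not-q) =
      ℕ.≮⇒≥ λ x<i → not-q (1≤x , 1≤y , subst (y ≤_) (sym (q-below x<i)) y≤px)

    p-next≤col : ∀ {c} → InSkew p q c → p (suc (row c)) ≤ col c
    p-next≤col {x , y} in-skew@((1≤x , 1≤y , _) , not-q) =
      ∸1<⇒≤ (ℕ.≰⇒> λ y≤ → not-q (1≤x , 1≤y , subst (y ≤_) (sym (q-above (row≥i in-skew))) y≤))

    in-H : ∀ {x y} → 1 ≤ x → 1 ≤ y → y ≤ p x → i ≤ x → p (suc x) ≤ y → (x , y) ∈ H
    in-H {x} {y} 1≤x 1≤y y≤px i≤x next≤y = ∈-skewCells⁺ antitone vanishes ((1≤x , 1≤y , y≤px) , not-q)
      where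
      not-q : ¬ InShape q (x , y)
      not-q (_ , _ , y≤qx) = ≤-pred-absurd 1≤y next≤y (subst (y ≤_) (q-above i≤x) y≤qx)

    H-skew : IsSkewDiagram H
    H-skew = skewCells-skew antitone vanishes q-antitone (λ L<x → q-vanishes (ℕ.<-trans (ℕ.n<1+n L′) L<x)) q≤p

    H-no2x2 : No2x2 H
    H-no2x2 x y (xy∈H , _ , _ , xy′∈H) =
      <-irrefl refl (≤-trans (proj₂ (proj₂ (proj₁ (∈-skewCells⁻ xy′∈H)))) (p-next≤col (∈-skewCells⁻ xy∈H)))

    last-cell : (suc L′ , 1) ∈ H
    last-cell = in-H (s≤s z≤n) ≤-refl last-nonempty i≤L (subst (_≤ 1) (sym (vanishes (ℕ.n<1+n (suc L′)))) z≤n)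

    H-terminal : Terminal H (suc L′)
    H-terminal = last-cell , λ c∈H → inShape-row≤ vanishes (proj₁ (∈-skewCells⁻ c∈H))

    H-connected : Connected H
    H-connected = connected-via-hub (λ {c} c∈H → descend (suc L′ ∸ row c) (ℕ.m∸n+n≡m (H-row≤ c∈H)) c∈H)
      where
      H-row≤ = proj₂ H-terminal
      descend : ∀ k {x y} → k + x ≡ suc L′ → (x , y) ∈ H → PathIn H (x , y) (suc L′ , 1)
      descend zero    refl xy∈H = RimHook.row-path H-skew last-cell xy∈H (proj₁ (proj₂ (proj₁ (∈-skewCells⁻ xy∈H))))
      descend (suc k) {x} {y} k+1+x≡L xy∈H =
        path-++ (RimHook.row-path H-skew corner xy∈H (p-next≤col in-skew))
                (step south below (descend k (trans (ℕ.+-suc k x) k+1+x≡L) below))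
        where
        in-skew = ∈-skewCells⁻ xy∈H
        1≤x = proj₁ (proj₁ in-skew)
        i≤x = row≥i in-skew
        x<L : suc x ≤ suc L′
        x<L = subst (suc x ≤_) k+1+x≡L (s≤s (ℕ.m≤n+m x k))
        1≤next = nonempty (s≤s z≤n) x<L
        corner : (x , p (suc x)) ∈ H
        corner = in-H 1≤x 1≤next (antitone 1≤x (n≤1+n x)) i≤x ≤-refl
        below : (suc x , p (suc x)) ∈ H
        below = in-H (s≤s z≤n) 1≤next ≤-refl (≤-trans i≤x (n≤1+n x)) (antitone (s≤s z≤n) (n≤1+n (suc x)))

    first-cell : (i , p i) ∈ H
    first-cell = in-H 1≤i (nonempty 1≤i i≤L) ≤-refl ≤-refl (antitone 1≤i (n≤1+n i))

    H-initial : Initial H (i , p i)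
    H-initial c∈H = let in-skew = ∈-skewCells⁻ c∈H in
      row≥i in-skew , ≤-trans (proj₂ (proj₂ (proj₁ in-skew))) (antitone 1≤i (row≥i in-skew))

    H-initial-on : InitialOnDiagonal H (i , p i)
    H-initial-on = _ , first-cell , H-initial , sameDiagonal refl

    H-initial-on⇒≡ : ∀ {x} → 1 ≤ x → InitialOnDiagonal H (x , p x) → x ≡ i
    H-initial-on⇒≡ 1≤x (c , c∈H , c-initial , c~x) with Initial-unique c∈H first-cell c-initial H-initial
    ... | refl = rowEnd-injective antitone 1≤x 1≤i (SameDiagonal-sym c~x)

    rowEnd-shrink : ∀ {x} → x ≤ L′ → SameDiagonal (x , q x) (skip i x , p (skip i x))
    rowEnd-shrink {x} x≤L′ with x <? i
    ... | yes _ = sameDiagonal refl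
    ... | no  _ = sameDiagonal (pred-shift x (nonempty (s≤s z≤n) (s≤s x≤L′)))

  record IsSRTOfShape (p : ℕ → ℕ) (R : List (List Cell)) : Set where
    field
      rimHooks    : ∀ g → g ∈ R → IsRimHook g
      firstColumn : ∀ g → g ∈ R → ∃ λ c → c ∈ g × col c ≡ 1
      inside      : ∀ g c → g ∈ R → c ∈ g → InShape p c
      covers      : ∀ c → InShape p c → ∃ λ g → g ∈ R × c ∈ g
      disjoint    : Unique (concat R)

  IsSRTOfShape⇒IsSRT : ∀ {μ R} → IsSRTOfShape (part μ) R → IsSRT μ R
  IsSRTOfShape⇒IsSRT srt = record { IsSRTOfShape srt }

  -- permSRT reads v on the diagonal through e; without a hook there, v is the row in which
  -- that diagonal meets column 0.
  Realises : List (List Cell) → Cell → ℕ → Set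
  Realises R e v = (hookOn (diagonalThrough e) R ≡ nothing × SameDiagonal (v , 0) e)
                 ⊎ (∃ λ g → hookOn (diagonalThrough e) R ≡ just g × terminalRow g ≡ just v)

  Realises-along : ∀ {R e e′ v} → SameDiagonal e e′ → Realises R e v → Realises R e′ v
  Realises-along {R} e~e′ (inj₁ (hookless , v~e)) =
    inj₁ (subst (λ d → hookOn d R ≡ nothing) (SameDiagonal⇒diagonalThrough (SameDiagonal-sym e~e′)) hookless ,
          SameDiagonal-trans v~e e~e′)
  Realises-along {R} e~e′ (inj₂ (g , hooked , terminal)) =
    inj₂ (g , subst (λ d → hookOn d R ≡ just g) (SameDiagonal⇒diagonalThrough (SameDiagonal-sym e~e′)) hooked , terminal)

  Realises-∷ : ∀ {R e v g} → ¬ InitialOnDiagonal g e → Realises R e v → Realises (g ∷ R) e v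
  Realises-∷ {R} not-on (inj₁ (hookless , v~e)) = inj₁ (trans (hookOn-there R not-on) hookless , v~e)
  Realises-∷ {R} not-on (inj₂ (g , hooked , terminal)) = inj₂ (g , trans (hookOn-there R not-on) hooked , terminal)

  Realises⇒permSRT : ∀ {μ R x v} → Realises R (x , part μ x) v → permSRT μ R x ≡ + v
  Realises⇒permSRT {μ} {R} {x} {v} (inj₁ (hookless , sameDiagonal x≡p+v)) =
    trans (permSRT-hookless μ R x hookless)
          (trans (pos-difference (subst (part μ x ≤_) (sym x≡p+v) (ℕ.m≤m+n (part μ x) v)))
                 (cong +_ (trans (cong (_∸ part μ x) x≡p+v) (ℕ.m+n∸m≡n (part μ x) v))))
  Realises⇒permSRT {μ} {R} {x} (inj₂ (g , hooked , terminal)) = permSRT-hooked μ R x hooked terminal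

  record Admissible (p : ℕ → ℕ) (L : ℕ) (σ : ℕ → ℕ) : Set where
    field
      antitone    : Antitone p
      vanishes    : VanishesAbove p L
      σ-range     : ∀ {x} → 1 ≤ x → x ≤ L → 1 ≤ σ x × σ x ≤ L
      σ-injective : ∀ {x y} → 1 ≤ x → x ≤ L → 1 ≤ y → y ≤ L → σ x ≡ σ y → x ≡ y
      σ-onto      : ∀ {y} → 1 ≤ y → y ≤ L → ∃ λ x → (1 ≤ x × x ≤ L) × σ x ≡ y
      fits        : ∀ {x} → 1 ≤ x → x ≤ L → x ≤ p x + σ x

  Realisation : (ℕ → ℕ) → ℕ → (ℕ → ℕ) → Set
  Realisation p L σ = ∃ λ R → IsSRTOfShape p R × (∀ {x} → 1 ≤ x → x ≤ L → Realises R (x , p x) (σ x))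

  fits-along : ∀ {x y x′ y′ v} → SameDiagonal (x′ , y′) (x , y) → x ≤ y + v → x′ ≤ y′ + v
  fits-along {x} {y} {x′} {y′} {v} (sameDiagonal y′+x≡y+x′) x≤y+v = ℕ.+-cancelʳ-≤ x x′ (y′ + v) (begin
    x′ + x        ≤⟨ ℕ.+-monoʳ-≤ x′ x≤y+v ⟩
    x′ + (y + v)  ≡⟨ shift-in x′ y v ⟩
    (y + x′) + v  ≡⟨ cong (_+ v) (sym y′+x≡y+x′) ⟩
    (y′ + x) + v  ≡⟨ shift-out y′ x v ⟩
    (y′ + v) + x  ∎)
    where
    open ℕ.≤-Reasoning
    shift-in : ∀ a b c → a + (b + c) ≡ (b + a) + c
    shift-in = solve-∀
    shift-out : ∀ a b c → (a + b) + c ≡ (a + c) + b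
    shift-out = solve-∀

  module EmptyLastRow {p σ L′} (admissible : Admissible p (suc L′) σ) (empty : p (suc L′) ≡ 0) where

    open Admissible admissible

    σ-last : σ (suc L′) ≡ suc L′
    σ-last = ≤-antisym (proj₂ (σ-range (s≤s z≤n) ≤-refl))
                       (subst (λ z → suc L′ ≤ z + σ (suc L′)) empty (fits (s≤s z≤n) ≤-refl))

    restricted-vanishes : VanishesAbove p L′
    restricted-vanishes {x} L′<x with ℕ.m≤n⇒m<n∨m≡n L′<x
    ... | inj₁ L<x  = vanishes L<x
    ... | inj₂ refl = empty

    below-last : ∀ {x} → 1 ≤ x → x ≤ L′ → σ x ≤ L′
    below-last {x} 1≤x x≤L′ = ℕ.s≤s⁻¹ (≤∧≢⇒< (proj₂ (σ-range 1≤x (m≤n⇒m≤1+n x≤L′))) not-last)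
      where
      not-last : σ x ≢ suc L′
      not-last σx≡L =
        <-irrefl (σ-injective 1≤x (m≤n⇒m≤1+n x≤L′) (s≤s z≤n) ≤-refl (trans σx≡L (sym σ-last))) (s≤s x≤L′)

    onto : ∀ {y} → 1 ≤ y → y ≤ L′ → ∃ λ x → (1 ≤ x × x ≤ L′) × σ x ≡ y
    onto {y} 1≤y y≤L′ = let (x , (1≤x , x≤L) , σx≡y) = σ-onto 1≤y (m≤n⇒m≤1+n y≤L′) in
      x , (1≤x , ℕ.s≤s⁻¹ (≤∧≢⇒< x≤L λ x≡L → <-irrefl (trans (sym σx≡y) (trans (cong σ x≡L) σ-last)) (s≤s y≤L′))) ,
      σx≡y

    restricted : Admissible p L′ σ
    restricted = record
      { antitone    = antitone
      ; vanishes    = restricted-vanishes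
      ; σ-range     = λ 1≤x x≤L′ → proj₁ (σ-range 1≤x (m≤n⇒m≤1+n x≤L′)) , below-last 1≤x x≤L′
      ; σ-injective = λ 1≤x x≤L′ 1≤y y≤L′ → σ-injective 1≤x (m≤n⇒m≤1+n x≤L′) 1≤y (m≤n⇒m≤1+n y≤L′)
      ; σ-onto      = onto
      ; fits        = λ 1≤x x≤L′ → fits 1≤x (m≤n⇒m≤1+n x≤L′)
      }

    extend : Realisation p L′ σ → Realisation p (suc L′) σ
    extend (R , srt , realises) = R , srt , realises′
      where
      open IsSRTOfShape srt
      off-diagonal : ∀ {g c} → g ∈ R → c ∈ g → ¬ SameDiagonal c (suc L′ , p (suc L′))
      off-diagonal {g} {c} g∈R c∈g (sameDiagonal c~L) =
        <-irrefl refl (≤-trans (s≤s (inShape-row≤ restricted-vanishes in-shape)) (≤-trans (s≤s (ℕ.m≤n+m L′ (col c)))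
          (≤-trans (ℕ.≤-reflexive (sym (ℕ.+-suc (col c) L′))) (ℕ.≤-reflexive (trans c~L (cong (_+ row c) empty))))))
        where in-shape = inside g c g∈R c∈g
      realises′ : ∀ {x} → 1 ≤ x → x ≤ suc L′ → Realises R (x , p x) (σ x)
      realises′ 1≤x x≤L with ℕ.m≤n⇒m<n∨m≡n x≤L
      ... | inj₁ x<L  = realises 1≤x (ℕ.s≤s⁻¹ x<L)
      ... | inj₂ refl = inj₁ (hookOn-absent R off-diagonal , sameDiagonal (trans (sym σ-last) (cong (_+ σ (suc L′)) (sym empty))))

  module NonemptyLastRow {p σ L′} (admissible : Admissible p (suc L′) σ) (last-nonempty : 1 ≤ p (suc L′)) where

    open Admissible admissible

    private
      last-preimage = σ-onto (s≤s z≤n) ≤-refl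
      i = proj₁ last-preimage
      1≤i = proj₁ (proj₁ (proj₂ last-preimage))
      i≤L = proj₂ (proj₁ (proj₂ last-preimage))
      σi≡L = proj₂ (proj₂ last-preimage)

    open RemoveHook antitone vanishes last-nonempty 1≤i i≤L public

    σ′ : ℕ → ℕ
    σ′ = σ ∘ skip i

    σ′-range : ∀ {x} → 1 ≤ x → x ≤ L′ → 1 ≤ σ′ x × σ′ x ≤ L′
    σ′-range {x} 1≤x x≤L′ = 1≤σ , ℕ.s≤s⁻¹ (≤∧≢⇒< σ≤L not-last)
      where
      skipped = skip-range 1≤x x≤L′
      1≤σ = proj₁ (σ-range (proj₁ skipped) (proj₂ skipped))
      σ≤L = proj₂ (σ-range (proj₁ skipped) (proj₂ skipped))
      not-last : σ′ x ≢ suc L′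
      not-last σ≡L = skip-≢ x (σ-injective (proj₁ skipped) (proj₂ skipped) 1≤i i≤L (trans σ≡L (sym σi≡L)))

    σ′-injective : ∀ {x y} → 1 ≤ x → x ≤ L′ → 1 ≤ y → y ≤ L′ → σ′ x ≡ σ′ y → x ≡ y
    σ′-injective 1≤x x≤L′ 1≤y y≤L′ eq = skip-injective
      (σ-injective (proj₁ (skip-range 1≤x x≤L′)) (proj₂ (skip-range 1≤x x≤L′))
                   (proj₁ (skip-range 1≤y y≤L′)) (proj₂ (skip-range 1≤y y≤L′)) eq)

    σ′-onto : ∀ {y} → 1 ≤ y → y ≤ L′ → ∃ λ x′ → (1 ≤ x′ × x′ ≤ L′) × σ′ x′ ≡ y
    σ′-onto {y} 1≤y y≤L′ =
      let (x , (1≤x , x≤L) , σx≡y) = σ-onto 1≤y (m≤n⇒m≤1+n y≤L′)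
          x≢i = λ x≡i → <-irrefl (trans (sym σx≡y) (trans (cong σ x≡i) σi≡L)) (s≤s y≤L′)
          (x′ , range , skip≡x) = skip-onto 1≤i i≤L x≢i 1≤x x≤L
      in x′ , range , trans (cong σ skip≡x) σx≡y

    reduced : Admissible q L′ σ′
    reduced = record
      { antitone    = q-antitone
      ; vanishes    = q-vanishes
      ; σ-range     = σ′-range
      ; σ-injective = σ′-injective
      ; σ-onto      = σ′-onto
      ; fits        = λ 1≤x x≤L′ → fits-along (rowEnd-shrink x≤L′)
                                     (fits (proj₁ (skip-range 1≤x x≤L′)) (proj₂ (skip-range 1≤x x≤L′)))
      }

    extend : Realisation q L′ σ′ → Realisation p (suc L′) σ
    extend (R′ , srt′ , realises′) = H ∷ R′ , srt , realises
      where
      module R′ = IsSRTOfShape srt′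
      srt : IsSRTOfShape p (H ∷ R′)
      srt = record
        { rimHooks    = λ { _ (here refl) → H-skew , H-connected , H-no2x2 ; g (there g∈R′) → R′.rimHooks g g∈R′ }
        ; firstColumn = λ { _ (here refl) → _ , last-cell , refl ; g (there g∈R′) → R′.firstColumn g g∈R′ }
        ; inside      = λ { _ _ (here refl) c∈H → proj₁ (SkewCells.∈-skewCells⁻ p q (suc L′) c∈H)
                          ; g c (there g∈R′) c∈g → let (1≤i , 1≤j , j≤q) = R′.inside g c g∈R′ c∈g in
                                                     1≤i , 1≤j , ≤-trans j≤q (q≤p 1≤i) }
        ; covers      = covers
        ; disjoint    = Unique.++⁺ (SkewCells.skewCells-unique p q (suc L′)) R′.disjoint λ (c∈H , c∈R′) →
                          let (g , c∈g , g∈R′) = ∈-concat⁻′ R′ c∈R′ in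
                          proj₂ (SkewCells.∈-skewCells⁻ p q (suc L′) c∈H) (R′.inside g _ g∈R′ c∈g)
        }
        where
        covers : ∀ c → InShape p c → ∃ λ g → g ∈ H ∷ R′ × c ∈ g
        covers c in-p with inShape? q c
        ... | yes in-q = let (g , g∈R′ , c∈g) = R′.covers c in-q in g , there g∈R′ , c∈g
        ... | no  ¬q   = H , here refl , SkewCells.∈-skewCells⁺ p q (suc L′) antitone vanishes (in-p , ¬q)
      realises : ∀ {x} → 1 ≤ x → x ≤ suc L′ → Realises (H ∷ R′) (x , p x) (σ x)
      realises {x} 1≤x x≤L with x ℕ.≟ i
      ... | yes refl = inj₂ (H , hookOn-here R′ H-initial-on ,
                             trans (RimHook.terminalRow-Terminal H-skew H-terminal) (cong just (sym σi≡L)))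
      ... | no  x≢i with skip-onto 1≤i i≤L x≢i 1≤x x≤L
      ...   | x′ , (1≤x′ , x′≤L′) , skip≡x = subst (λ z → Realises (H ∷ R′) (z , p z) (σ z)) skip≡x
                (Realises-∷ {R′} (λ on → skip-≢ x′ (H-initial-on⇒≡ (proj₁ (skip-range 1≤x′ x′≤L′)) on))
                            (Realises-along {R′} (rowEnd-shrink x′≤L′) (realises′ 1≤x′ x′≤L′)))

  build : ∀ L {p σ} → Admissible p L σ → Realisation p L σ
  build zero {p} admissible = [] , srt , λ 1≤x x≤0 → contradiction (≤-trans 1≤x x≤0) λ ()
    where
    srt : IsSRTOfShape p []
    srt = record
      { rimHooks = λ _ ()
      ; firstColumn = λ _ ()
      ; inside = λ _ _ ()
      ; covers = λ c in-p → contradiction (≤-trans (proj₁ in-p) (inShape-row≤ (Admissible.vanishes admissible) in-p)) λ ()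
      ; disjoint = []
      }
  build (suc L′) {p} admissible with p (suc L′) ℕ.≟ 0
  ... | yes empty = EmptyLastRow.extend admissible empty (build L′ (EmptyLastRow.restricted admissible empty))
  ... | no  p≢0   = NonemptyLastRow.extend admissible 1≤p (build L′ (NonemptyLastRow.reduced admissible 1≤p))
    where 1≤p = ℕ.n≢0⇒n>0 p≢0

  module _ {μ : List ℕ} (partition : IsPartition μ) (σ : Permutation′ (length μ)) where

    private
      ℓ = length μ
      σℕ = onPositions (λ i → pos (σ ⟨$⟩ʳ i))
      σℕ-pos : ∀ i → σℕ (pos i) ≡ pos (σ ⟨$⟩ʳ i)
      σℕ-pos = onPositions-pos (λ i → pos (σ ⟨$⟩ʳ i))

    permutation-admissible : (∀ i → + 0 ℤ.≤ (+ part μ (pos i) ℤ.- + pos i) ℤ.+ + pos (σ ⟨$⟩ʳ i)) →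
      Admissible (part μ) ℓ σℕ
    permutation-admissible fits = record
      { antitone    = part-antitone (proj₁ partition)
      ; vanishes    = part-vanishes μ
      ; σ-range     = at-position (λ x → 1 ≤ σℕ x × σℕ x ≤ ℓ) λ i →
                        subst (λ v → 1 ≤ v × v ≤ ℓ) (sym (σℕ-pos i)) (s≤s z≤n , toℕ<n _)
      ; σ-injective = λ 1≤x x≤ℓ 1≤y y≤ℓ → at-position (λ x → ∀ {y} → 1 ≤ y → y ≤ ℓ → σℕ x ≡ σℕ y → x ≡ y)
                        (λ i → at-position (λ y → σℕ (pos i) ≡ σℕ y → pos i ≡ y) λ j eq →
                          cong pos (permutation-injective (pos-injective (trans (sym (σℕ-pos i)) (trans eq (σℕ-pos j))))))
                        1≤x x≤ℓ 1≤y y≤ℓ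
      ; σ-onto      = at-position (λ y → ∃ λ x → (1 ≤ x × x ≤ ℓ) × σℕ x ≡ y) λ k →
                        pos (σ ⟨$⟩ˡ k) , (s≤s z≤n , toℕ<n _) , trans (σℕ-pos _) (cong pos (inverseʳ σ))
      ; fits        = at-position (λ x → x ≤ part μ x + σℕ x) λ i →
                        subst (λ v → pos i ≤ part μ (pos i) + v) (sym (σℕ-pos i))
                          (0≤difference+pos⇒≤ {part μ (pos i)} {pos i} {pos (σ ⟨$⟩ʳ i)} (fits i))
      }
      where
      permutation-injective : ∀ {i j} → σ ⟨$⟩ʳ i ≡ σ ⟨$⟩ʳ j → i ≡ j
      permutation-injective eq = trans (sym (inverseˡ σ)) (trans (cong (σ ⟨$⟩ˡ_) eq) (inverseˡ σ))

  IsPermOfSomeSRT : (μ : List ℕ) → (Fin (length μ) → ℤ) → Set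
  IsPermOfSomeSRT μ τ = ∃ λ R → IsSRT μ R × (∀ i → permSRT μ R (pos i) ≡ τ i)

  IsAdmissiblePermutation : (μ : List ℕ) → (Fin (length μ) → ℤ) → Set
  IsAdmissiblePermutation μ τ = Σ (Permutation′ (length μ)) λ σ →
    (∀ i → τ i ≡ + pos (σ ⟨$⟩ʳ i)) × (∀ i → + 0 ℤ.≤ (+ part μ (pos i) ℤ.- + pos i) ℤ.+ + pos (σ ⟨$⟩ʳ i))

  module _ {μ : List ℕ} (partition : IsPartition μ) {τ : Fin (length μ) → ℤ} where

    permOfSRT⇒admissible : IsPermOfSomeSRT μ τ → IsAdmissiblePermutation μ τ
    permOfSRT⇒admissible (R , srt , perm≡τ) with Tableau.permSRT-permutation partition srt
    ... | σ , perm≡σ = σ , (λ i → trans (sym (perm≡τ i)) (perm≡σ i)) ,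
                       (λ i → subst (λ v → + 0 ℤ.≤ (+ part μ (pos i) ℤ.- + pos i) ℤ.+ v) (perm≡σ i)
                                    (Tableau.permSRT-admissible partition srt (pos i)))

    admissible⇒permOfSRT : IsAdmissiblePermutation μ τ → IsPermOfSomeSRT μ τ
    admissible⇒permOfSRT (σ , τ≡σ , fits) with build (length μ) (permutation-admissible partition σ fits)
    ... | R , srt , realises = R , IsSRTOfShape⇒IsSRT srt ,
          λ i → trans (Realises⇒permSRT {μ} {R} (realises (s≤s z≤n) (toℕ<n i)))
                      (trans (cong +_ (onPositions-pos _ i)) (sym (τ≡σ i)))

open import Defs
open import Data.Nat using (ℕ)
open import Data.Integer as ℤ using (ℤ; +_; _≤_)
open import Data.List using (List; length)
open import Data.Nat.ListAction using (sum)
open import Data.Fin using (Fin)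
open import Data.Fin.Permutation using (Permutation′; _⟨$⟩ʳ_)
open import Data.Product using (Σ; ∃; _×_; _,_)
open import Function.Bundles using (_⇔_; mk⇔)
open import Relation.Binary.PropositionalEquality using (_≡_)
open RimHookTableaux using (module Tableau; permOfSRT⇒admissible; admissible⇒permOfSRT)

lemma6p11 : (n : ℕ) (λ' : List ℕ) → IsPartition λ' → sum λ' ≡ n →
    ((R : List (List Cell)) → IsSRT λ' R →
      (i : Fin (length λ')) →
        + Γ λ' R (pos i) ≡ (+ part λ' (pos i) ℤ.- + pos i) ℤ.+ permSRT λ' R (pos i))
    ×
    ((τ : Fin (length λ') → ℤ) →
      (∃ λ R → IsSRT λ' R × ((i : Fin (length λ')) → permSRT λ' R (pos i) ≡ τ i))
      ⇔
      (Σ (Permutation′ (length λ')) λ σ →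
        ((i : Fin (length λ')) → τ i ≡ + pos (σ ⟨$⟩ʳ i)) ×
        ((i : Fin (length λ')) → + 0 ≤ (+ part λ' (pos i) ℤ.- + pos i) ℤ.+ + pos (σ ⟨$⟩ʳ i))))
lemma6p11 _ λ' partition _ =
  (λ R srt i → Tableau.Γ-formula partition srt (pos i)) ,
  (λ τ → mk⇔ (permOfSRT⇒admissible partition) (admissible⇒permOfSRT partition))
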